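{- In the setting described in the context, the map $\psi:\mathcal D(\pi)\to\mathcal D(\hat\pi)$ is well defined: for every $(\pi_i,\pi_j,k)\in\mathcal D(\pi)$ its image is a defect of $\hat\pi$ lying in $\mathcal D(\hat\pi)$. Moreover $\psi(\mathcal A)\subseteq\mathcal A'$, $\psi(\mathcal B)\subseteq\mathcal B'$, $\psi(\mathcal C_1)\subseteq\mathcal C'_1$ and $\psi(\mathcal C_2)\subseteq\mathcal C'_2$.
   Context: A planar network of order $n$ is a directed, planar, acyclic multigraph embedded in the plane with $n$ sources on the left and $n$ sinks on the right, labeled $1,\dots,n$ bottom to top; edges may carry positive integer multiplicities. For an interval $[a,b]\subseteq[n]$, the simple star network $F_{[a,b]}$ has one interior vertex $x$, edges source $i\to x\to$ sink $i$ for $i\in[a,b]$ and source $i\to$ sink $i$ otherwise. A star network $F=F_{[a_1,b_1]}\cdots F_{[a_m,b_m]}$ is built from these by any combination of concatenation (identify sink $i$ of the left piece with source $i$ of the right piece, merging edges) and condensed concatenation (additionally merge $p>1$ parallel edges between two interior vertices into one edge of multiplicity $p$); its interior vertices are $x_1,\dots,x_m$. A covering path family $\pi=(\pi_1,\dots,\pi_n)\in\Pi(F)$ consists of source-to-sink paths, $\pi_i$ from source $i$, with each edge of multiplicity $p$ on exactly $p$ paths. Components of the intersection of two paths are vertices or paths $(x_k,\dots,x_\ell)$; the paths meet at the initial vertex $x_k$ of each component, which is a crossing if they enter $x_k$ and exit $x_\ell$ in different vertical orders. A defect at $x_k$ is a triple $(\pi_i,\pi_j,k)$, $i<j$, with $\pi_i,\pi_j$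 meeting at $x_k$ after having crossed an odd number of times. For paths through $x_k$: $\pi_a\prec\pi_b$ if $\pi_a$ enters $x_k$ on an edge below that of $\pi_b$; $\pi_a\sim\pi_b$ if they enter on the same edge; $\pi_a\precsim\pi_b$ if either. Setting: fix $k\in\{2,\dots,m\}$ and $\pi\in\Pi(F)$ with a defect at $x_k$. Let $(r,t)$ be the lexicographically least pair with $(\pi_r,\pi_t,k)$ a defect; let $s$ be the largest index with $\pi_s\sim\pi_r$ at $x_k$ and $(\pi_s,\pi_t,k)$ a defect; let $x_\ell$ be the final vertex of the rightmost crossing of $\pi_s,\pi_t$ prior to $x_k$; define $\hat\pi$ by $\hat\pi_i=\pi_i$ ($i\notin\{s,t\}$), and $\hat\pi_s$ ($\hat\pi_t$) equal to $\pi_s$ ($\pi_t$) with its $x_\ell$-to-$x_k$ subpath replaced by that of $\pi_t$ ($\pi_s$). Let $\mathcal D(\pi)$ be the set of defects $(\pi_i,\pi_j,k)$ of $\pi$ at $x_k$ with $|\{i,j\}\cap\{s,t\}|=1$, and $\mathcal D(\hat\pi)$ the analogous set for $\hat\pi$. Relations are at $x_k$. $\mathcal A=\{(\pi_i,\pi_j,k)\in\mathcal D(\pi):\pi_j\prec\pi_t\}$, $\mathcal B=\{\cdots:\pi_s\prec\pi_i\}$, $\mathcal C_1=\{\cdots:\pi_t\precsim\pi_j\prec\pi_i,\ i=s,\ j\ne t\}$, $\mathcal C_2=\{\cdots:j=t,\ \pi_t\prec\pi_i\precsim\pi_s,\ i\ne s\}$; $\mathcal A'=\{(\hat\pi_i,\hat\pi_j,k)\in\mathcal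 D(\hat\pi):\hat\pi_j\prec\hat\pi_s\}$, $\mathcal B'=\{\cdots:\hat\pi_t\prec\hat\pi_i\}$, $\mathcal C'_1=\{\cdots:\hat\pi_s\precsim\hat\pi_j\prec\hat\pi_i,\ i=t,\ j\ne s\}$, $\mathcal C'_2=\{\cdots:j=s,\ \hat\pi_s\prec\hat\pi_i\precsim\hat\pi_t,\ i\ne t\}$. The map $\psi$ (on $\mathcal D(\pi)=\mathcal A\uplus\mathcal B\uplus\mathcal C_1\uplus\mathcal C_2$) sends $(\pi_i,\pi_j,k)\mapsto(\hat\pi_i,\hat\pi_j,k)$ if it lies in $\mathcal A\cup\mathcal B$; $(\pi_s,\pi_j,k)\in\mathcal C_1\mapsto(\hat\pi_t,\hat\pi_j,k)$; $(\pi_i,\pi_t,k)\in\mathcal C_2\mapsto(\hat\pi_i,\hat\pi_s,k)$. -}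

module Defs where

open import Data.Nat using (ℕ; zero; suc; _+_; _≤_; _≡ᵇ_; _<ᵇ_; _≤ᵇ_)
open import Data.Fin using (Fin; zero; suc; toℕ; inject₁; splitAt)
open import Data.Bool using (Bool; true; false; _∧_; _∨_; not; if_then_else_; _xor_)
open import Data.Sum using (inj₁; inj₂)
open import Function using (_∘_)
open import Data.Product using (_×_)
open import Relation.Binary.PropositionalEquality using (_≡_)
open import Data.Bool using (T)

allF : ∀ {k} → (Fin k → Bool) → Bool
allF {zero}  f = true
allF {suc k} f = f zero ∧ allF (f ∘ suc)

anyF : ∀ {k} → (Fin k → Bool) → Bool
anyF {zero}  f = false
anyF {suc k} f = f zero ∨ anyF (f ∘ suc)

countF : ∀ {k} → (Fin k → Bool) → ℕ
countF {zero}  f = 0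
countF {suc k} f = (if f zero then 1 else 0) + countF (f ∘ suc)

odd : ℕ → Bool
odd zero    = false
odd (suc k) = not (odd k)

_==_ : ∀ {k} → Fin k → Fin k → Bool
i == j = toℕ i ≡ᵇ toℕ j

_<ᶠ_ : ∀ {k} → Fin k → Fin k → Bool
i <ᶠ j = toℕ i <ᵇ toℕ j

_≤ᶠ_ : ∀ {k} → Fin k → Fin k → Bool
i ≤ᶠ j = toℕ i ≤ᵇ toℕ j

_⇒_ : Bool → Bool → Bool
a ⇒ b = not a ∨ b

-- Star networks of order n with m interior vertices, as built from simple
-- star networks F_[a,b] by concatenation (flag false) and condensed
-- concatenation (flag true).  Levels (sources/sinks) are Fin n (0-based,
-- bottom to top); interior vertices x_1..x_m are Fin m (0-based, left to right).

data StarExpr (n : ℕ) : ℕ → Set where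
  star : (a b : Fin n) → toℕ a ≤ toℕ b → StarExpr n 1
  cat  : ∀ {m₁ m₂} → Bool → StarExpr n m₁ → StarExpr n m₂ → StarExpr n (m₁ + m₂)

lo : ∀ {n m} → StarExpr n m → Fin m → Fin n
lo (star a b _) _ = a
lo (cat {m₁} _ L R) p with splitAt m₁ p
... | inj₁ p' = lo L p'
... | inj₂ p' = lo R p'

hi : ∀ {n m} → StarExpr n m → Fin m → Fin n
hi (star a b _) _ = b
hi (cat {m₁} _ L R) p with splitAt m₁ p
... | inj₁ p' = hi L p'
... | inj₂ p' = hi R p'

-- cond F p q : the parallel edges from x_p to x_q (p left of q) were
-- merged, i.e. they were created by a condensed concatenation.
cond : ∀ {n m} → StarExpr n m → Fin m → Fin m → Bool
cond (star _ _ _) p q = false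
cond (cat {m₁} c L R) p q with splitAt m₁ p | splitAt m₁ q
... | inj₁ p' | inj₁ q' = cond L p' q'
... | inj₂ p' | inj₂ q' = cond R p' q'
... | inj₁ _  | inj₂ _  = c
... | inj₂ _  | inj₁ _  = false

-- A source-to-sink path is recorded by the level of the
-- wire it travels on in each gap g ∈ Fin (suc m) (gap g lies just left of
-- x_g and just right of x_{g-1}).

Family : ℕ → ℕ → Set
Family n m = Fin n → Fin (suc m) → Fin n

module _ {n m : ℕ} (F : StarExpr n m) where

  inI : Fin m → Fin n → Bool
  inI p i = (toℕ (lo F p) ≤ᵇ toℕ i) ∧ (toℕ i ≤ᵇ toℕ (hi F p))

  isPrev : Fin m → Fin n → Fin m → Bool
  isPrev k i q = (q <ᶠ k) ∧ inI q i ∧ allF (λ r → not ((q <ᶠ r) ∧ (r <ᶠ k) ∧ inI r i))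

  isNext : Fin m → Fin n → Fin m → Bool
  isNext p i q = (p <ᶠ q) ∧ inI q i ∧ allF (λ r → not ((p <ᶠ r) ∧ (r <ᶠ q) ∧ inI r i))

  -- the wire segments at levels i and j entering x_k form the same edge
  sameIn : Fin m → Fin n → Fin n → Bool
  sameIn k i j = inI k i ∧ inI k j ∧
    ((i == j) ∨ anyF (λ q → isPrev k i q ∧ isPrev k j q ∧ cond F q k))

  sameOut : Fin m → Fin n → Fin n → Bool
  sameOut p i j = inI p i ∧ inI p j ∧
    ((i == j) ∨ anyF (λ q → isNext p i q ∧ isNext p j q ∧ cond F p q))

  -- the in-edge of x_k containing level i lies below that containing level j
  -- (vertical position of an edge = its lowest wire level)
  belowIn : Fin m → Fin n → Fin n → Bool
  belowIn k i j = inI k i ∧ inI k j ∧ not (sameIn k i j) ∧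
    anyF (λ i' → sameIn k i i' ∧ allF (λ j' → sameIn k j j' ⇒ (i' <ᶠ j')))

  belowOut : Fin m → Fin n → Fin n → Bool
  belowOut p i j = inI p i ∧ inI p j ∧ not (sameOut p i j) ∧
    anyF (λ i' → sameOut p i i' ∧ allF (λ j' → sameOut p j j' ⇒ (i' <ᶠ j')))

  validStep : (Fin (suc m) → Fin n) → Fin m → Bool
  validStep h p = if inI p (h (inject₁ p)) then inI p (h (suc p))
                  else (h (suc p) == h (inject₁ p))

  -- π ∈ Π(F): each π_a is a path of F starting at source a, and every edge
  -- of multiplicity μ is used by exactly μ paths (equivalently: in every
  -- gap, the paths occupy distinct wires).
  IsCovering : Family n m → Set
  IsCovering π = (∀ a p → T (validStep (π a) p))
    × (∀ a → π a zero ≡ a)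
    × (∀ g a b → π a g ≡ π b g → a ≡ b)

  module _ (π : Family n m) where

    visits : Fin n → Fin m → Bool
    visits a p = inI p (π a (inject₁ p))

    simAt : Fin m → Fin n → Fin n → Bool
    simAt k a b = sameIn k (π a (inject₁ k)) (π b (inject₁ k))

    precAt : Fin m → Fin n → Fin n → Bool
    precAt k a b = belowIn k (π a (inject₁ k)) (π b (inject₁ k))

    precsimAt : Fin m → Fin n → Fin n → Bool
    precsimAt k a b = precAt k a b ∨ simAt k a b

    -- π_a, π_b meet at x_k: x_k is the initial vertex of a component of
    -- their intersection
    meetAt : Fin m → Fin n → Fin n → Bool
    meetAt k a b = visits a k ∧ visits b k ∧ not (simAt k a b)

    -- x_ℓ is the final vertex of a component
    finalAt : Fin m → Fin n → Fin n → Bool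
    finalAt ℓ a b = visits a ℓ ∧ visits b ℓ ∧ not (sameOut ℓ (π a (suc ℓ)) (π b (suc ℓ)))

    compEnd : Fin m → Fin m → Fin n → Fin n → Bool
    compEnd k ℓ a b = meetAt k a b ∧ (k ≤ᶠ ℓ) ∧ finalAt ℓ a b ∧
      allF (λ p → ((k ≤ᶠ p) ∧ (p <ᶠ ℓ)) ⇒ not (finalAt p a b))

    crossingAt : Fin m → Fin n → Fin n → Bool
    crossingAt k a b = meetAt k a b ∧ anyF (λ ℓ → compEnd k ℓ a b ∧
      ((precAt k a b ∧ belowOut ℓ (π b (suc ℓ)) (π a (suc ℓ))) ∨
       (precAt k b a ∧ belowOut ℓ (π a (suc ℓ)) (π b (suc ℓ)))))

    defect : Fin m → Fin n → Fin n → Bool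
    defect k i j = (i <ᶠ j) ∧ meetAt k i j ∧
      odd (countF (λ p → (p <ᶠ k) ∧ crossingAt p i j))

    inD : Fin m → Fin n → Fin n → Fin n → Fin n → Bool
    inD k s t i j = defect k i j ∧ (((i == s) ∨ (i == t)) xor ((j == s) ∨ (j == t)))

    inA inB inC1 inC2 : Fin m → Fin n → Fin n → Fin n → Fin n → Bool
    inA k s t i j = inD k s t i j ∧ precAt k j t
    inB k s t i j = inD k s t i j ∧ precAt k s i
    inC1 k s t i j = inD k s t i j ∧ precsimAt k t j ∧ precAt k j i ∧ (i == s) ∧ not (j == t)
    inC2 k s t i j = inD k s t i j ∧ (j == t) ∧ precAt k t i ∧ precsimAt k i s ∧ not (i == s)

    -- primed sets, to be applied to π̂ (roles of s and t interchanged)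
    inA' inB' inC1' inC2' : Fin m → Fin n → Fin n → Fin n → Fin n → Bool
    inA' k s t i j = inD k s t i j ∧ precAt k j s
    inB' k s t i j = inD k s t i j ∧ precAt k t i
    inC1' k s t i j = inD k s t i j ∧ precsimAt k s j ∧ precAt k j i ∧ (i == t) ∧ not (j == s)
    inC2' k s t i j = inD k s t i j ∧ (j == s) ∧ precAt k s i ∧ precsimAt k i t ∧ not (i == t)

-- π̂ : swap the x_ℓ-to-x_k subpaths (gaps ℓ+1, …, k) of π_s and π_t

hat : ∀ {n m} → Family n m → Fin n → Fin n → Fin m → Fin m → Family n m
hat π s t ℓ k i g =
  if (i == s) then (if inside then π t g else π s g)
  else if (i == t) then (if inside then π s g else π t g)
  else π i g
  where inside = (toℕ ℓ <ᵇ toℕ g) ∧ (toℕ g ≤ᵇ toℕ k)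

{-# OPTIONS --safe #-}
-- Write σ for the transposition (s t).  Crossings are the only places where two
-- paths change their vertical order, so by induction along the gaps between
-- interior vertices, if π_a and π_b (a < b) meet at x_k then π_b enters x_k below
-- π_a iff they have crossed an odd number of times before.  Hence, for any
-- covering family, (π_i, π_j, k) is a defect iff i < j and π_j ≺ π_i at x_k.
-- The last crossing of π_s and π_t ends before x_k, so π̂ is again a covering
-- family, and at x_k it is π reindexed by σ: π̂_i ≺ π̂_j iff π_σi ≺ π_σj.
-- Each inclusion ψ(𝒳) ⊆ 𝒳′ then follows from t ≺ s, the lexicographic
-- minimality of (r, t) and the maximality of s.
module Submission where

open import Defs
open import Data.Nat using (ℕ; zero; suc; _+_; _≤_; _<_; _<ᵇ_; _≤ᵇ_; z≤n; s≤s; s≤s⁻¹)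
open import Data.Nat.Properties
  using (_<?_; <ᵇ⇒<; <⇒<ᵇ; ≤ᵇ⇒≤; ≤⇒≤ᵇ; ≡ᵇ⇒≡; ≡⇒≡ᵇ; ≤-refl; ≤-antisym; <⇒≤; <-trans;
         <-irrefl; <-asym; <⇒≢; ≤-<-trans; <-≤-trans; <⇒≱; ≤∧≢⇒<; m<1+n⇒m<n∨m≡n; m≤n⇒m<n∨m≡n;
         n<1+n; ≮⇒≥; +-identityʳ; +-comm; +-assoc)
open import Data.Fin using (Fin; zero; suc; toℕ; inject₁)
open import Data.Fin.Properties using (toℕ-injective; toℕ-inject₁; <-cmp; _≟_)
import Data.Fin.Properties as Fin
open import Data.Fin.Induction using (<-weakInduction)
open import Data.Fin.Permutation.Components using (transpose)
open import Data.Bool using (Bool; true; false; T; not; _∧_; _∨_; _xor_; if_then_else_)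
open import Data.Bool.Properties using (T-∧; T-∨; T?; if-float; ∨-identityʳ; xor-identityʳ)
open import Data.Product using (Σ; _×_; _,_; proj₁; proj₂)
open import Data.Sum using (_⊎_; inj₁; inj₂; [_,_]; [_,_]′; map₂)
open import Data.Empty using (⊥-elim)
open import Level using (0ℓ)
open import Function using (id; _∘_; _⇔_; mk⇔; Equivalence)
import Function.Properties.Equivalence as ⇔
open import Relation.Nullary using (¬_; Dec; yes; no; contradiction)
open import Relation.Nullary.Decidable using (_⊎-dec_; dec-true; dec-false; decidable-stable)
open import Relation.Unary using (Pred; Decidable)
open import Relation.Binary using (Rel; IsEquivalence; tri<; tri≈; tri>)
open import Relation.Binary.PropositionalEquality
  using (_≡_; _≢_; refl; sym; trans; cong; cong₂; subst; module ≡-Reasoning)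

open Equivalence using (to; from)

T-∧⁻ : ∀ a {b} → T (a ∧ b) → T a × T b
T-∧⁻ a = to (T-∧ {a})

T-∧⁺ : ∀ {a b} → T a → T b → T (a ∧ b)
T-∧⁺ {true} _ q = q

T-∨⁻ : ∀ a {b} → T (a ∨ b) → T a ⊎ T b
T-∨⁻ a = to (T-∨ {a})

T-∨⁺ˡ : ∀ {a} b → T a → T (a ∨ b)
T-∨⁺ˡ {true} _ _ = _

T-∨⁺ʳ : ∀ a {b} → T b → T (a ∨ b)
T-∨⁺ʳ true  _ = _
T-∨⁺ʳ false q = q

T-not⁺ : ∀ {a} → ¬ T a → T (not a)
T-not⁺ {true}  ¬a = ¬a _
T-not⁺ {false} _  = _

T-not⁻ : ∀ {a} → T (not a) → ¬ T a
T-not⁻ {true} ()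

T-∧∧not⇔ : ∀ a b {c} → T (a ∧ b ∧ not c) ⇔ (T a × T b × ¬ T c)
T-∧∧not⇔ a b = mk⇔
  (λ h → let ha , h′ = T-∧⁻ a h
             hb , hc = T-∧⁻ b h′
         in ha , hb , T-not⁻ hc)
  (λ (ha , hb , ¬hc) → T-∧⁺ ha (T-∧⁺ hb (T-not⁺ ¬hc)))

T-⇒⁻ : ∀ {a b} → T (a ⇒ b) → T a → T b
T-⇒⁻ {true} q _ = q

T-⇒⁺ : ∀ {a b} → (T a → T b) → T (a ⇒ b)
T-⇒⁺ {true}  f = f _
T-⇒⁺ {false} _ = _

T-xor⁺ˡ : ∀ {a b} → T a → ¬ T b → T (a xor b)
T-xor⁺ˡ {true} {true}  _ ¬b = ¬b _
T-xor⁺ˡ {true} {false} _ _  = _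

T-xor⁺ʳ : ∀ {a b} → ¬ T a → T b → T (a xor b)
T-xor⁺ʳ {true}  ¬a _ = ⊥-elim (¬a _)
T-xor⁺ʳ {false} _  b = b

T-xor⁻ : ∀ {a b} → T (a xor b) → T a ⊎ T b
T-xor⁻ {true}  _ = inj₁ _
T-xor⁻ {false} b = inj₂ b

T-ext : ∀ {a b} → (T a → T b) → (T b → T a) → a ≡ b
T-ext {true}  {true}  _ _ = refl
T-ext {true}  {false} f _ = ⊥-elim (f _)
T-ext {false} {true}  _ g = ⊥-elim (g _)
T-ext {false} {false} _ _ = refl

if-T : ∀ {A : Set} {b} {x y : A} → T b → (if b then x else y) ≡ x
if-T {b = true} _ = refl

if-F : ∀ {A : Set} {b} {x y : A} → ¬ T b → (if b then x else y) ≡ y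
if-F {b = true}  ¬b = contradiction _ ¬b
if-F {b = false} _  = refl

if-same : ∀ {A : Set} b {x : A} → (if b then x else x) ≡ x
if-same true  = refl
if-same false = refl

allF⁻ : ∀ {k} {f : Fin k → Bool} → T (allF f) → ∀ i → T (f i)
allF⁻ {f = f} h zero    = proj₁ (T-∧⁻ (f zero) h)
allF⁻ {f = f} h (suc i) = allF⁻ {f = f ∘ suc} (proj₂ (T-∧⁻ (f zero) h)) i

allF⁺ : ∀ {k} {f : Fin k → Bool} → (∀ i → T (f i)) → T (allF f)
allF⁺ {zero}  _ = _
allF⁺ {suc k} h = T-∧⁺ (h zero) (allF⁺ (h ∘ suc))

anyF⁻ : ∀ {k} {f : Fin k → Bool} → T (anyF f) → Σ (Fin k) (T ∘ f)
anyF⁻ {suc k} {f} h with T-∨⁻ (f zero) h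
... | inj₁ h₀ = zero , h₀
... | inj₂ hₛ with anyF⁻ {f = f ∘ suc} hₛ
...   | i , hᵢ = suc i , hᵢ

anyF⁺ : ∀ {k} {f : Fin k → Bool} i → T (f i) → T (anyF f)
anyF⁺ {f = f} zero    h = T-∨⁺ˡ (anyF (f ∘ suc)) h
anyF⁺ {f = f} (suc i) h = T-∨⁺ʳ (f zero) (anyF⁺ {f = f ∘ suc} i h)

𝟙[_] : Bool → ℕ
𝟙[ b ] = if b then 1 else 0

countF-false : ∀ k → countF {k} (λ _ → false) ≡ 0
countF-false zero    = refl
countF-false (suc k) = countF-false k

countF-upTo-suc : ∀ {k} (f : Fin k → Bool) (r : Fin k) →
  countF (λ p → (toℕ p <ᵇ suc (toℕ r)) ∧ f p) ≡ countF (λ p → (toℕ p <ᵇ toℕ r) ∧ f p) + 𝟙[ f r ]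
countF-upTo-suc f zero = +-comm 𝟙[ f zero ] _
countF-upTo-suc f (suc r) = begin
  𝟙[ f zero ] + countF (λ p → (toℕ p <ᵇ suc (toℕ r)) ∧ f (suc p))
    ≡⟨ cong (𝟙[ f zero ] +_) (countF-upTo-suc (f ∘ suc) r) ⟩
  𝟙[ f zero ] + (countF (λ p → (toℕ p <ᵇ toℕ r) ∧ f (suc p)) + 𝟙[ f (suc r) ])
    ≡⟨ sym (+-assoc 𝟙[ f zero ] _ 𝟙[ f (suc r) ]) ⟩
  𝟙[ f zero ] + countF (λ p → (toℕ p <ᵇ toℕ r) ∧ f (suc p)) + 𝟙[ f (suc r) ]  ∎
  where open ≡-Reasoning

odd-+-𝟙 : ∀ x b → odd (x + 𝟙[ b ]) ≡ b xor odd x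
odd-+-𝟙 x false = cong odd (+-identityʳ x)
odd-+-𝟙 x true  = cong odd (+-comm x 1)

T-odd-cong : ∀ {x y} → x ≡ y → T (odd x) ⇔ T (odd y)
T-odd-cong refl = ⇔.refl

∨-as-xor : ∀ p q → (not p ∧ q) ∨ (p ∧ not q) ≡ p xor q
∨-as-xor true  q = refl
∨-as-xor false q = ∨-identityʳ q

xor-cancelʳ : ∀ p q → (p xor q) xor p ≡ q
xor-cancelʳ true  true  = refl
xor-cancelʳ true  false = refl
xor-cancelʳ false q     = xor-identityʳ q

<ᶠ⇒< : ∀ {k} {i j : Fin k} → T (i <ᶠ j) → toℕ i < toℕ j
<ᶠ⇒< {i = i} {j} = <ᵇ⇒< (toℕ i) (toℕ j)

<⇒<ᶠ : ∀ {k} {i j : Fin k} → toℕ i < toℕ j → T (i <ᶠ j)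
<⇒<ᶠ = <⇒<ᵇ

≤ᶠ⇒≤ : ∀ {k} {i j : Fin k} → T (i ≤ᶠ j) → toℕ i ≤ toℕ j
≤ᶠ⇒≤ {i = i} {j} = ≤ᵇ⇒≤ (toℕ i) (toℕ j)

≤⇒≤ᶠ : ∀ {k} {i j : Fin k} → toℕ i ≤ toℕ j → T (i ≤ᶠ j)
≤⇒≤ᶠ = ≤⇒≤ᵇ

==⇒≡ : ∀ {k} {i j : Fin k} → T (i == j) → i ≡ j
==⇒≡ {i = i} {j} h = toℕ-injective (≡ᵇ⇒≡ (toℕ i) (toℕ j) h)

≡⇒== : ∀ {k} {i j : Fin k} → i ≡ j → T (i == j)
≡⇒== {i = i} refl = ≡⇒≡ᵇ (toℕ i) (toℕ i) refl

transpose-left : ∀ {k} (s t : Fin k) → transpose s t s ≡ t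
transpose-left s t rewrite dec-true (s ≟ s) refl = refl

transpose-right : ∀ {k} {s t : Fin k} → s ≢ t → transpose s t t ≡ s
transpose-right {s = s} {t} s≢t rewrite dec-false (t ≟ s) (s≢t ∘ sym) | dec-true (t ≟ t) refl = refl

transpose-other : ∀ {k} {s t i : Fin k} → i ≢ s → i ≢ t → transpose s t i ≡ i
transpose-other {s = s} {t} {i} i≢s i≢t rewrite dec-false (i ≟ s) i≢s | dec-false (i ≟ t) i≢t = refl

least : ∀ {k} (P : Pred (Fin k) 0ℓ) → Decidable P → ∀ {w} → P w →
        Σ (Fin k) λ u → P u × (∀ v → P v → toℕ u ≤ toℕ v)
least {suc k} P P? {w} Pw with P? zero
... | yes P₀ = zero , P₀ , λ _ _ → z≤n
least {suc k} P P? {zero}  Pw | no ¬P₀ = contradiction Pw ¬P₀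
least {suc k} P P? {suc w} Pw | no ¬P₀ with least (P ∘ suc) (P? ∘ suc) Pw
... | u , Pu , u-least = suc u , Pu , λ where
  zero    P₀ → contradiction P₀ ¬P₀
  (suc v) Pv → s≤s (u-least v Pv)

ClassBelow : ∀ {n} → Rel (Fin n) 0ℓ → Rel (Fin n) 0ℓ
ClassBelow {n} _≈_ u v = ¬ u ≈ v × Σ (Fin n) λ u′ → u ≈ u′ × (∀ v′ → v ≈ v′ → toℕ u′ < toℕ v′)

ClassBelow-cong : ∀ {n} {S S′ : Rel (Fin n) 0ℓ} {u v} →
  (∀ {w} → S u w ⇔ S′ u w) → (∀ {w} → S v w ⇔ S′ v w) → ClassBelow S u v → ClassBelow S′ u v
ClassBelow-cong [u] [v] (u≉v , u′ , u≈u′ , u′<[v]) =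
  u≉v ∘ from [u] , u′ , to [u] u≈u′ , λ v′ → u′<[v] v′ ∘ from [v]

module _ {n} {_≈_ : Rel (Fin n) 0ℓ} (≈-isEquivalence : IsEquivalence _≈_) where
  open IsEquivalence ≈-isEquivalence renaming (refl to ≈-refl; sym to ≈-sym; trans to ≈-trans)

  ClassBelow-irrefl : ∀ {u} → ¬ ClassBelow _≈_ u u
  ClassBelow-irrefl (u≉u , _) = u≉u ≈-refl

  ClassBelow-trans : ∀ {u v w} → ClassBelow _≈_ u v → ClassBelow _≈_ v w → ClassBelow _≈_ u w
  ClassBelow-trans (_ , u′ , u≈u′ , u′<[v]) (_ , v′ , v≈v′ , v′<[w]) =
    (λ u≈w → <-irrefl refl (<-trans (u′<[v] v′ v≈v′) (v′<[w] u′ (≈-trans (≈-sym u≈w) u≈u′)))) ,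
    u′ , u≈u′ , λ w′ w≈w′ → <-trans (u′<[v] v′ v≈v′) (v′<[w] w′ w≈w′)

  ClassBelow-respʳ : ∀ {u v w} → ClassBelow _≈_ u v → v ≈ w → ClassBelow _≈_ u w
  ClassBelow-respʳ (u≉v , u′ , u≈u′ , u′<[v]) v≈w =
    (λ u≈w → u≉v (≈-trans u≈w (≈-sym v≈w))) , u′ , u≈u′ , λ w′ w≈w′ → u′<[v] w′ (≈-trans v≈w w≈w′)

  -- The least wire of the two classes decides which one lies below.
  ClassBelow-total : ∀ {u v} → Decidable (u ≈_) → Decidable (v ≈_) → ¬ u ≈ v →
                     ClassBelow _≈_ u v ⊎ ClassBelow _≈_ v u
  ClassBelow-total {u} {v} u≈? v≈? u≉v
    with least (λ w → u ≈ w ⊎ v ≈ w) (λ w → u≈? w ⊎-dec v≈? w) (inj₁ ≈-refl)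
  ... | w , inj₁ u≈w , w-least = inj₁ (u≉v , w , u≈w , λ v′ v≈v′ →
          Fin.≤∧≢⇒< (w-least v′ (inj₂ v≈v′)) λ { refl → u≉v (≈-trans u≈w (≈-sym v≈v′)) })
  ... | w , inj₂ v≈w , w-least = inj₂ (u≉v ∘ ≈-sym , w , v≈w , λ u′ u≈u′ →
          Fin.≤∧≢⇒< (w-least u′ (inj₁ u≈u′)) λ { refl → u≉v (≈-trans u≈u′ (≈-sym v≈w)) })

module ClassOrder {n} (ι : Fin n → Bool) (R : Fin n → Fin n → Bool)
  {S : Rel (Fin n) 0ℓ} (S-isEquivalence : IsEquivalence S)
  (R⇔ : ∀ {u v} → T (R u v) ⇔ (T (ι u) × T (ι v) × S u v))
  (S-closed : ∀ {u v} → T (ι u) → S u v → T (ι v)) where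

  below : Fin n → Fin n → Bool
  below u v = ι u ∧ ι v ∧ not (R u v) ∧ anyF (λ u′ → R u u′ ∧ allF (λ v′ → R v v′ ⇒ (u′ <ᶠ v′)))

  private
    R⁺ : ∀ {u v} → T (ι u) → S u v → T (R u v)
    R⁺ ιu Suv = from R⇔ (ιu , S-closed ιu Suv , Suv)

    R⁻ : ∀ {u v} → T (R u v) → S u v
    R⁻ = proj₂ ∘ proj₂ ∘ to R⇔

  below⇔ : ∀ {u v} → T (below u v) ⇔ (T (ι u) × T (ι v) × ClassBelow S u v)
  below⇔ {u} {v} = mk⇔ decode encode
    where
    decode : T (below u v) → T (ι u) × T (ι v) × ClassBelow S u v
    decode h =
      let ιu , h₁ = T-∧⁻ (ι u) h
          ιv , h₂ = T-∧⁻ (ι v) h₁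
          ¬Ruv , h₃ = T-∧⁻ (not (R u v)) h₂
          u′ , h₄ = anyF⁻ {f = λ u′ → R u u′ ∧ allF (λ v′ → R v v′ ⇒ (u′ <ᶠ v′))} h₃
          Ruu′ , h₅ = T-∧⁻ (R u u′) h₄
      in ιu , ιv , T-not⁻ ¬Ruv ∘ R⁺ ιu , u′ , R⁻ Ruu′ , λ v′ Svv′ →
         <ᶠ⇒< (T-⇒⁻ (allF⁻ {f = λ v′ → R v v′ ⇒ (u′ <ᶠ v′)} h₅ v′) (R⁺ ιv Svv′))
    encode : T (ι u) × T (ι v) × ClassBelow S u v → T (below u v)
    encode (ιu , ιv , u≉v , u′ , Suu′ , u′<[v]) =
      T-∧⁺ ιu (T-∧⁺ ιv (T-∧⁺ (T-not⁺ (u≉v ∘ R⁻)) (anyF⁺ u′ (T-∧⁺ (R⁺ ιu Suu′)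
        (allF⁺ λ v′ → T-⇒⁺ (<⇒<ᶠ ∘ u′<[v] v′ ∘ R⁻))))))

  below⇔ClassBelow : ∀ {u v} → T (ι u) → T (ι v) → T (below u v) ⇔ ClassBelow S u v
  below⇔ClassBelow ιu ιv = mk⇔ (proj₂ ∘ proj₂ ∘ to below⇔) (λ uv → from below⇔ (ιu , ιv , uv))

  below-irrefl : ∀ {u} → ¬ T (below u u)
  below-irrefl = ClassBelow-irrefl S-isEquivalence ∘ proj₂ ∘ proj₂ ∘ to below⇔

  below-trans : ∀ {u v w} → T (below u v) → T (below v w) → T (below u w)
  below-trans uv vw =
    let ιu , _ , uv′ = to below⇔ uv
        _ , ιw , vw′ = to below⇔ vw
    in from below⇔ (ιu , ιw , ClassBelow-trans S-isEquivalence uv′ vw′)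

  below-asym : ∀ {u v} → T (below u v) → ¬ T (below v u)
  below-asym uv vu = below-irrefl (below-trans uv vu)

  below-respʳ : ∀ {u v w} → T (below u v) → T (R v w) → T (below u w)
  below-respʳ uv Rvw =
    let ιu , _ , uv′ = to below⇔ uv
        _ , ιw , Svw = to R⇔ Rvw
    in from below⇔ (ιu , ιw , ClassBelow-respʳ S-isEquivalence uv′ Svw)

  below-flip : ∀ {u v} → T (ι u) → T (ι v) → ¬ T (R u v) → below u v ≡ not (below v u)
  below-flip {u} {v} ιu ιv ¬Ruv = T-ext (T-not⁺ ∘ below-asym) λ ¬vu →
    [ (λ uv → from below⇔ (ιu , ιv , uv)) , (λ vu → contradiction (from below⇔ (ιv , ιu , vu)) (T-not⁻ ¬vu)) ]
    (ClassBelow-total S-isEquivalence (S? ιu) (S? ιv) (¬Ruv ∘ R⁺ ιu))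
    where
    S? : ∀ {u} → T (ι u) → Decidable (S u)
    S? {u} ιu w with T? (R u w)
    ... | yes Ruw = yes (R⁻ Ruw)
    ... | no ¬Ruw = no (¬Ruw ∘ R⁺ ιu)

module Edges {n m} (F : StarExpr n m) where

  In : Fin m → Fin n → Set
  In p w = T (inI F p w)

  In? : ∀ p w → Dec (In p w)
  In? p w = T? (inI F p w)

  In-lo : ∀ {p w} → In p w → toℕ (lo F p) ≤ toℕ w
  In-lo {p} {w} = ≤ᵇ⇒≤ _ _ ∘ proj₁ ∘ T-∧⁻ (toℕ (lo F p) ≤ᵇ toℕ w)

  In-hi : ∀ {p w} → In p w → toℕ w ≤ toℕ (hi F p)
  In-hi {p} {w} = ≤ᵇ⇒≤ _ _ ∘ proj₂ ∘ T-∧⁻ (toℕ (lo F p) ≤ᵇ toℕ w)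

  In⁺ : ∀ {p w} → toℕ (lo F p) ≤ toℕ w → toℕ w ≤ toℕ (hi F p) → In p w
  In⁺ lo≤w w≤hi = T-∧⁺ (≤⇒≤ᵇ lo≤w) (≤⇒≤ᵇ w≤hi)

  -- Gap x lies just left of x_x.  x_P is the last vertex on wire w left of gap x,
  -- x_N the first one right of it.
  Prev : ℕ → Fin n → Fin m → Set
  Prev x w P = toℕ P < x × In P w × (∀ q → toℕ P < toℕ q → toℕ q < x → ¬ In q w)

  Next : ℕ → Fin n → Fin m → Set
  Next x w N = x ≤ toℕ N × In N w × (∀ q → x ≤ toℕ q → toℕ q < toℕ N → ¬ In q w)

  -- u and v lie on one edge of multiplicity > 1, from x_tail to x_head.
  record Condensed (x : ℕ) (u v : Fin n) : Set where
    constructor condensed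
    field
      tail head : Fin m
      tail-u    : Prev x u tail
      tail-v    : Prev x v tail
      head-u    : Next x u head
      head-v    : Next x v head
      merged    : T (cond F tail head)

  SameEdge : ℕ → Rel (Fin n) 0ℓ
  SameEdge x u v = u ≡ v ⊎ Condensed x u v

  Prev-unique : ∀ {x w P P′} → Prev x w P → Prev x w P′ → P ≡ P′
  Prev-unique {P = P} {P′} (P<x , wP , clear) (P′<x , wP′ , clear′) with <-cmp P P′
  ... | tri< P<P′ _ _ = contradiction wP′ (clear P′ P<P′ P′<x)
  ... | tri≈ _ P≡P′ _ = P≡P′
  ... | tri> _ _ P′<P = contradiction wP (clear′ P P′<P P<x)

  Next-unique : ∀ {x w N N′} → Next x w N → Next x w N′ → N ≡ N′
  Next-unique {N = N} {N′} (x≤N , wN , clear) (x≤N′ , wN′ , clear′) with <-cmp N N′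
  ... | tri< N<N′ _ _ = contradiction wN (clear′ N x≤N N<N′)
  ... | tri≈ _ N≡N′ _ = N≡N′
  ... | tri> _ _ N′<N = contradiction wN′ (clear N′ x≤N′ N′<N)

  SameEdge-sym : ∀ {x u v} → SameEdge x u v → SameEdge x v u
  SameEdge-sym (inj₁ refl) = inj₁ refl
  SameEdge-sym (inj₂ (condensed P N uP vP uN vN c)) = inj₂ (condensed P N vP uP vN uN c)

  SameEdge-trans : ∀ {x u v w} → SameEdge x u v → SameEdge x v w → SameEdge x u w
  SameEdge-trans (inj₁ refl) vw = vw
  SameEdge-trans uv (inj₁ refl) = uv
  SameEdge-trans (inj₂ (condensed P N uP vP uN vN c)) (inj₂ (condensed P′ N′ vP′ wP′ vN′ wN′ _))
    with Prev-unique vP vP′ | Next-unique vN vN′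
  ... | refl | refl = inj₂ (condensed P N uP wP′ uN wN′ c)

  SameEdge-isEquivalence : ∀ {x} → IsEquivalence (SameEdge x)
  SameEdge-isEquivalence = record { refl = inj₁ refl ; sym = SameEdge-sym ; trans = SameEdge-trans }

  SameEdge-start : ∀ {u v} → SameEdge 0 u v → u ≡ v
  SameEdge-start (inj₁ u≡v) = u≡v
  SameEdge-start (inj₂ (condensed _ _ (() , _) _ _ _ _))

  SameEdge-inject₁ : ∀ (q : Fin m) {u v} → SameEdge (toℕ (inject₁ q)) u v → SameEdge (toℕ q) u v
  SameEdge-inject₁ q {u} {v} = subst (λ x → SameEdge x u v) (toℕ-inject₁ q)

  Next-self : ∀ {k w} → In k w → Next (toℕ k) w k
  Next-self wk = ≤-refl , wk , λ _ k≤q q<k → contradiction (≤-<-trans k≤q q<k) (<-irrefl refl)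

  Prev-self : ∀ {p w} → In p w → Prev (suc (toℕ p)) w p
  Prev-self wp = ≤-refl , wp , λ _ p<q q≤p → contradiction (<-≤-trans p<q (s≤s⁻¹ q≤p)) (<-irrefl refl)

  SameEdge-In : ∀ {k u v} → In k u → SameEdge (toℕ k) u v → In k v
  SameEdge-In uk (inj₁ refl) = uk
  SameEdge-In uk (inj₂ (condensed _ _ _ _ uN (_ , vN , _) _)) with Next-unique uN (Next-self uk)
  ... | refl = vN

  SameEdge-Out : ∀ {p u v} → In p u → SameEdge (suc (toℕ p)) u v → In p v
  SameEdge-Out up (inj₁ refl) = up
  SameEdge-Out up (inj₂ (condensed _ _ uP (_ , vP , _) _ _ _)) with Prev-unique uP (Prev-self up)
  ... | refl = vP

  clear⇔ : ∀ {w} (P N : Fin m) →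
    T (allF (λ q → not ((P <ᶠ q) ∧ (q <ᶠ N) ∧ inI F q w))) ⇔
    (∀ q → toℕ P < toℕ q → toℕ q < toℕ N → ¬ In q w)
  clear⇔ {w} P N = mk⇔
    (λ h q P<q q<N wq → T-not⁻ (allF⁻ {f = λ q → not ((P <ᶠ q) ∧ (q <ᶠ N) ∧ inI F q w)} h q)
                                 (T-∧⁺ (<⇒<ᶠ P<q) (T-∧⁺ (<⇒<ᶠ q<N) wq)))
    (λ h → allF⁺ λ q → T-not⁺ λ h′ →
      let P<q , h″ = T-∧⁻ (P <ᶠ q) h′
          q<N , wq = T-∧⁻ (q <ᶠ N) h″
      in h q (<ᶠ⇒< P<q) (<ᶠ⇒< q<N) wq)

  isPrev⇔ : ∀ {k w P} → T (isPrev F k w P) ⇔ Prev (toℕ k) w P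
  isPrev⇔ {k} {w} {P} = mk⇔
    (λ h → let P<k , h′ = T-∧⁻ (P <ᶠ k) h
               wP , c = T-∧⁻ (inI F P w) h′
           in <ᶠ⇒< P<k , wP , to (clear⇔ P k) c)
    (λ (P<k , wP , c) → T-∧⁺ (<⇒<ᶠ P<k) (T-∧⁺ wP (from (clear⇔ P k) c)))

  isNext⇔ : ∀ {p w N} → T (isNext F p w N) ⇔ Next (suc (toℕ p)) w N
  isNext⇔ {p} {w} {N} = mk⇔
    (λ h → let p<N , h′ = T-∧⁻ (p <ᶠ N) h
               wN , c = T-∧⁻ (inI F N w) h′
           in <ᶠ⇒< p<N , wN , to (clear⇔ p N) c)
    (λ (p<N , wN , c) → T-∧⁺ (<⇒<ᶠ p<N) (T-∧⁺ wN (from (clear⇔ p N) c)))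

  sameIn⇔ : ∀ {k u v} → T (sameIn F k u v) ⇔ (In k u × In k v × SameEdge (toℕ k) u v)
  sameIn⇔ {k} {u} {v} = mk⇔ decode encode
    where
    decode : T (sameIn F k u v) → In k u × In k v × SameEdge (toℕ k) u v
    decode h with T-∧⁻ (inI F k u) h
    ... | uk , h₁ with T-∧⁻ (inI F k v) h₁
    ... | vk , h₂ with T-∨⁻ (u == v) h₂
    ... | inj₁ u=v = uk , vk , inj₁ (==⇒≡ u=v)
    ... | inj₂ h₃ with anyF⁻ {f = λ q → isPrev F k u q ∧ isPrev F k v q ∧ cond F q k} h₃
    ...   | P , h₄ with T-∧⁻ (isPrev F k u P) h₄
    ...     | uP , h₅ with T-∧⁻ (isPrev F k v P) h₅
    ...       | vP , c = uk , vk , inj₂ (condensed P k (to isPrev⇔ uP) (to isPrev⇔ vP) (Next-self uk) (Next-self vk) c)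
    encode : In k u × In k v × SameEdge (toℕ k) u v → T (sameIn F k u v)
    encode (uk , vk , inj₁ refl) = T-∧⁺ uk (T-∧⁺ vk (T-∨⁺ˡ _ (≡⇒== {i = u} refl)))
    encode (uk , vk , inj₂ (condensed P N uP vP uN _ c)) with Next-unique uN (Next-self uk)
    ... | refl = T-∧⁺ uk (T-∧⁺ vk (T-∨⁺ʳ (u == v)
                   (anyF⁺ P (T-∧⁺ (from isPrev⇔ uP) (T-∧⁺ (from isPrev⇔ vP) c)))))

  sameOut⇔ : ∀ {p u v} → T (sameOut F p u v) ⇔ (In p u × In p v × SameEdge (suc (toℕ p)) u v)
  sameOut⇔ {p} {u} {v} = mk⇔ decode encode
    where
    decode : T (sameOut F p u v) → In p u × In p v × SameEdge (suc (toℕ p)) u v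
    decode h with T-∧⁻ (inI F p u) h
    ... | up , h₁ with T-∧⁻ (inI F p v) h₁
    ... | vp , h₂ with T-∨⁻ (u == v) h₂
    ... | inj₁ u=v = up , vp , inj₁ (==⇒≡ u=v)
    ... | inj₂ h₃ with anyF⁻ {f = λ q → isNext F p u q ∧ isNext F p v q ∧ cond F p q} h₃
    ...   | N , h₄ with T-∧⁻ (isNext F p u N) h₄
    ...     | uN , h₅ with T-∧⁻ (isNext F p v N) h₅
    ...       | vN , c = up , vp , inj₂ (condensed p N (Prev-self up) (Prev-self vp) (to isNext⇔ uN) (to isNext⇔ vN) c)
    encode : In p u × In p v × SameEdge (suc (toℕ p)) u v → T (sameOut F p u v)
    encode (up , vp , inj₁ refl) = T-∧⁺ up (T-∧⁺ vp (T-∨⁺ˡ _ (≡⇒== {i = u} refl)))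
    encode (up , vp , inj₂ (condensed P N uP _ uN vN c)) with Prev-unique uP (Prev-self up)
    ... | refl = T-∧⁺ up (T-∧⁺ vp (T-∨⁺ʳ (u == v)
                   (anyF⁺ N (T-∧⁺ (from isNext⇔ uN) (T-∧⁺ (from isNext⇔ vN) c)))))

  module BelowIn (k : Fin m) = ClassOrder (inI F k) (sameIn F k) SameEdge-isEquivalence sameIn⇔ SameEdge-In
  module BelowOut (p : Fin m) = ClassOrder (inI F p) (sameOut F p) SameEdge-isEquivalence sameOut⇔ SameEdge-Out

  -- How a class avoiding the interval of x_r compares with a class inside it
  -- depends on the former alone.
  module _ {S : Rel (Fin n) 0ℓ} (S-isEquivalence : IsEquivalence S) (r : Fin m) {u v : Fin n}
           (u-out : ∀ {w} → S u w → ¬ In r w) (v-in : ∀ {w} → S v w → In r w) where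
    open IsEquivalence S-isEquivalence renaming (refl to S-refl; sym to S-sym)

    ClassBelow-into⇔ : ClassBelow S u v ⇔ (Σ (Fin n) λ u′ → S u u′ × toℕ u′ < toℕ (lo F r))
    ClassBelow-into⇔ = mk⇔
      (λ (_ , u′ , Suu′ , u′<[v]) →
         u′ , Suu′ , below-lo Suu′ (<⇒≤ (<-≤-trans (u′<[v] v S-refl) (In-hi (v-in S-refl)))))
      (λ (u′ , Suu′ , u′<lo) →
         (λ Suv → u-out Suv (v-in S-refl)) , u′ , Suu′ , λ v′ Svv′ → <-≤-trans u′<lo (In-lo (v-in Svv′)))
      where
      below-lo : ∀ {w} → S u w → toℕ w ≤ toℕ (hi F r) → toℕ w < toℕ (lo F r)
      below-lo {w} Suw w≤hi with toℕ w <? toℕ (lo F r)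
      ... | yes w<lo = w<lo
      ... | no  w≮lo = contradiction (In⁺ (≮⇒≥ w≮lo) w≤hi) (u-out Suw)

    ClassBelow-out-of⇔ : ClassBelow S v u ⇔ (∀ u′ → S u u′ → toℕ (hi F r) < toℕ u′)
    ClassBelow-out-of⇔ = mk⇔
      (λ (_ , v′ , Svv′ , v′<[u]) u′ Suu′ →
         above-hi Suu′ (<⇒≤ (≤-<-trans (In-lo (v-in Svv′)) (v′<[u] u′ Suu′))))
      (λ hi<[u] →
         (λ Svu → u-out (S-sym Svu) (v-in S-refl)) , v , S-refl ,
         λ u′ Suu′ → ≤-<-trans (In-hi (v-in S-refl)) (hi<[u] u′ Suu′))
      where
      above-hi : ∀ {w} → S u w → toℕ (lo F r) ≤ toℕ w → toℕ (hi F r) < toℕ w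
      above-hi {w} Suw lo≤w with toℕ (hi F r) <? toℕ w
      ... | yes hi<w = hi<w
      ... | no  hi≮w = contradiction (In⁺ lo≤w (≮⇒≥ hi≮w)) (u-out Suw)

  module Across (r : Fin m) where

    private
      not-at : ∀ {w} → ¬ In r w → ∀ q → toℕ q ≡ toℕ r → ¬ In q w
      not-at {w} w∉r q q≡r = subst (λ q → ¬ In q w) (sym (toℕ-injective q≡r)) w∉r

    Prev-across : ∀ {w P} → ¬ In r w → Prev (toℕ r) w P ⇔ Prev (suc (toℕ r)) w P
    Prev-across w∉r = mk⇔
      (λ (P<r , wP , clear) → <-trans P<r (n<1+n _) , wP ,
         λ q P<q q≤r → [ clear q P<q , not-at w∉r q ] (m<1+n⇒m<n∨m≡n q≤r))
      (λ (P≤r , wP , clear) → [ id , (λ P≡r → contradiction wP (not-at w∉r _ P≡r)) ] (m<1+n⇒m<n∨m≡n P≤r) ,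
         wP , λ q P<q q<r → clear q P<q (<-trans q<r (n<1+n _)))

    Next-across : ∀ {w N} → ¬ In r w → Next (toℕ r) w N ⇔ Next (suc (toℕ r)) w N
    Next-across w∉r = mk⇔
      (λ (r≤N , wN , clear) → [ id , (λ r≡N → contradiction wN (not-at w∉r _ (sym r≡N))) ] (m≤n⇒m<n∨m≡n r≤N) ,
         wN , λ q r<q q<N → clear q (<⇒≤ r<q) q<N)
      (λ (r<N , wN , clear) → <⇒≤ r<N , wN ,
         λ q r≤q q<N → [ (λ r<q → clear q r<q q<N) , (λ r≡q → not-at w∉r q (sym r≡q)) ] (m≤n⇒m<n∨m≡n r≤q))

    SameEdge-across : ∀ {u v} → ¬ In r u → SameEdge (toℕ r) u v ⇔ SameEdge (suc (toℕ r)) u v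
    SameEdge-across {u} {v} u∉r with In? r v
    ... | yes v∈r = mk⇔ (λ e → contradiction (SameEdge-In v∈r (SameEdge-sym e)) u∉r)
                        (λ e → contradiction (SameEdge-Out v∈r (SameEdge-sym e)) u∉r)
    ... | no  v∉r = mk⇔
      (map₂ λ (condensed P N uP vP uN vN c) → condensed P N (to (Prev-across u∉r) uP) (to (Prev-across v∉r) vP)
                                                         (to (Next-across u∉r) uN) (to (Next-across v∉r) vN) c)
      (map₂ λ (condensed P N uP vP uN vN c) → condensed P N (from (Prev-across u∉r) uP) (from (Prev-across v∉r) vP)
                                                         (from (Next-across u∉r) uN) (from (Next-across v∉r) vN) c)

    private
      outside-before : ∀ {u w} → ¬ In r u → SameEdge (toℕ r) u w → ¬ In r w
      outside-before u∉r e w∈r = u∉r (SameEdge-In w∈r (SameEdge-sym e))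

      outside-after : ∀ {u w} → ¬ In r u → SameEdge (suc (toℕ r)) u w → ¬ In r w
      outside-after u∉r e w∈r = u∉r (SameEdge-Out w∈r (SameEdge-sym e))

    ClassBelow-across-outside : ∀ {u v} → ¬ In r u → ¬ In r v →
      ClassBelow (SameEdge (toℕ r)) u v ⇔ ClassBelow (SameEdge (suc (toℕ r))) u v
    ClassBelow-across-outside u∉r v∉r = mk⇔
      (ClassBelow-cong {S = SameEdge (toℕ r)} (SameEdge-across u∉r) (SameEdge-across v∉r))
      (ClassBelow-cong {S = SameEdge (suc (toℕ r))} (⇔.sym (SameEdge-across u∉r)) (⇔.sym (SameEdge-across v∉r)))

    ClassBelow-across-into : ∀ {u v v′} → ¬ In r u → In r v → In r v′ →
      ClassBelow (SameEdge (toℕ r)) u v ⇔ ClassBelow (SameEdge (suc (toℕ r))) u v′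
    ClassBelow-across-into u∉r v∈r v′∈r =
      ⇔.trans (ClassBelow-into⇔ SameEdge-isEquivalence r (outside-before u∉r) (SameEdge-In v∈r))
     (⇔.trans (mk⇔ (λ (u′ , e , u′<lo) → u′ , to (SameEdge-across u∉r) e , u′<lo)
                   (λ (u′ , e , u′<lo) → u′ , from (SameEdge-across u∉r) e , u′<lo))
              (⇔.sym (ClassBelow-into⇔ SameEdge-isEquivalence r (outside-after u∉r) (SameEdge-Out v′∈r))))

    ClassBelow-across-out-of : ∀ {u v v′} → ¬ In r u → In r v → In r v′ →
      ClassBelow (SameEdge (toℕ r)) v u ⇔ ClassBelow (SameEdge (suc (toℕ r))) v′ u
    ClassBelow-across-out-of u∉r v∈r v′∈r =
      ⇔.trans (ClassBelow-out-of⇔ SameEdge-isEquivalence r (outside-before u∉r) (SameEdge-In v∈r))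
     (⇔.trans (mk⇔ (λ hi<[u] u′ e → hi<[u] u′ (from (SameEdge-across u∉r) e))
                   (λ hi<[u] u′ e → hi<[u] u′ (to (SameEdge-across u∉r) e)))
              (⇔.sym (ClassBelow-out-of⇔ SameEdge-isEquivalence r (outside-after u∉r) (SameEdge-Out v′∈r))))

  validStep-in : ∀ {h : Fin (suc m) → Fin n} {p} → T (validStep F h p) → In p (h (inject₁ p)) → In p (h (suc p))
  validStep-in {h} {p} valid _ with inI F p (h (inject₁ p))
  ... | true = valid

  validStep-out : ∀ {h : Fin (suc m) → Fin n} {p} → T (validStep F h p) → ¬ In p (h (inject₁ p)) →
                  h (suc p) ≡ h (inject₁ p)
  validStep-out {h} {p} valid ∉p with inI F p (h (inject₁ p))
  ... | true  = contradiction _ ∉p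
  ... | false = ==⇒≡ valid

  validStep-cong : ∀ (h h′ : Fin (suc m) → Fin n) {p} → h (inject₁ p) ≡ h′ (inject₁ p) → h (suc p) ≡ h′ (suc p) →
                   T (validStep F h′ p) → T (validStep F h p)
  validStep-cong h h′ e e′ valid rewrite e | e′ = valid

  validStep-inside : ∀ (h : Fin (suc m) → Fin n) {p} → In p (h (inject₁ p)) → In p (h (suc p)) →
                     T (validStep F h p)
  validStep-inside h {p} _ ∈p′ with inI F p (h (inject₁ p))
  ... | true = ∈p′

module Paths {n m} (F : StarExpr n m) (π : Family n m) (valid : ∀ i p → T (validStep F (π i) p)) where
  open Edges F

  NoFinal : Fin n → Fin n → Fin m → ℕ → Set
  NoFinal i j p y = ∀ q → toℕ p ≤ toℕ q → toℕ q < y → ¬ T (finalAt F π q i j)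

  stays-inside : ∀ {i p} → In p (π i (inject₁ p)) → In p (π i (suc p))
  stays-inside {i} {p} = validStep-in {h = π i} (valid i p)

  passes-by : ∀ {i p} → ¬ In p (π i (inject₁ p)) → π i (suc p) ≡ π i (inject₁ p)
  passes-by {i} {p} = validStep-out {h = π i} (valid i p)

  NoFinal-extend : ∀ {i j p r} → NoFinal i j p (toℕ r) → ¬ T (finalAt F π r i j) → NoFinal i j p (suc (toℕ r))
  NoFinal-extend {i} {j} {r = r} before ¬final q p≤q q≤r = [ before q p≤q , not-r ] (m<1+n⇒m<n∨m≡n q≤r)
    where
    not-r : toℕ q ≡ toℕ r → ¬ T (finalAt F π q i j)
    not-r q≡r = subst (λ q → ¬ T (finalAt F π q i j)) (sym (toℕ-injective q≡r)) ¬final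

  meetAt⇔ : ∀ {p i j} → T (meetAt F π p i j) ⇔
    (In p (π i (inject₁ p)) × In p (π j (inject₁ p)) × ¬ T (simAt F π p i j))
  meetAt⇔ {p} {i} {j} = T-∧∧not⇔ (visits F π i p) (visits F π j p)

  finalAt⇔ : ∀ {p i j} → T (finalAt F π p i j) ⇔
    (In p (π i (inject₁ p)) × In p (π j (inject₁ p)) × ¬ T (sameOut F p (π i (suc p)) (π j (suc p))))
  finalAt⇔ {p} {i} {j} = T-∧∧not⇔ (visits F π i p) (visits F π j p)

  compEnd⇔ : ∀ {p ℓ i j} → T (compEnd F π p ℓ i j) ⇔
    (T (meetAt F π p i j) × toℕ p ≤ toℕ ℓ × T (finalAt F π ℓ i j) × NoFinal i j p (toℕ ℓ))
  compEnd⇔ {p} {ℓ} {i} {j} = mk⇔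
    (λ h → let meet , h₁ = T-∧⁻ (meetAt F π p i j) h
               p≤ℓ , h₂ = T-∧⁻ (p ≤ᶠ ℓ) h₁
               final , h₃ = T-∧⁻ (finalAt F π ℓ i j) h₂
           in meet , ≤ᶠ⇒≤ p≤ℓ , final , λ q p≤q q<ℓ →
              T-not⁻ (T-⇒⁻ (allF⁻ {f = λ q → ((p ≤ᶠ q) ∧ (q <ᶠ ℓ)) ⇒ not (finalAt F π q i j)} h₃ q)
                            (T-∧⁺ (≤⇒≤ᶠ p≤q) (<⇒<ᶠ q<ℓ))))
    (λ (meet , p≤ℓ , final , before) → T-∧⁺ meet (T-∧⁺ (≤⇒≤ᶠ p≤ℓ) (T-∧⁺ final (allF⁺ λ q → T-⇒⁺ λ h →
       let p≤q , q<ℓ = T-∧⁻ (p ≤ᶠ q) h in T-not⁺ (before q (≤ᶠ⇒≤ p≤q) (<ᶠ⇒< q<ℓ))))))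

  compEnd-unique : ∀ {p ℓ ℓ′ i j} → T (compEnd F π p ℓ i j) → T (compEnd F π p ℓ′ i j) → ℓ ≡ ℓ′
  compEnd-unique {ℓ = ℓ} {ℓ′} ce ce′ with to compEnd⇔ ce | to compEnd⇔ ce′ | <-cmp ℓ ℓ′
  ... | _ , p≤ℓ , final , _ | _ , _ , _ , before′ | tri< ℓ<ℓ′ _ _ = contradiction final (before′ ℓ p≤ℓ ℓ<ℓ′)
  ... | _ | _ | tri≈ _ ℓ≡ℓ′ _ = ℓ≡ℓ′
  ... | _ , _ , _ , before | _ , p≤ℓ′ , final′ , _ | tri> _ _ ℓ′<ℓ = contradiction final′ (before ℓ′ p≤ℓ′ ℓ′<ℓ)

  crossingAt-end : ∀ {p ℓ i j} → T (compEnd F π p ℓ i j) →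
    crossingAt F π p i j ≡ precAt F π p j i xor belowOut F ℓ (π j (suc ℓ)) (π i (suc ℓ))
  crossingAt-end {p} {ℓ} {i} {j} ce with to compEnd⇔ ce
  ... | meet , _ , final , _ with to meetAt⇔ meet | to finalAt⇔ final
  ...   | ∈i , ∈j , ¬sim | ∈iℓ , ∈jℓ , ¬same = begin
      crossingAt F π p i j
        ≡⟨ T-ext at-ℓ (λ h → T-∧⁺ meet (anyF⁺ ℓ (T-∧⁺ ce h))) ⟩
      (precAt F π p i j ∧ Q) ∨ (P ∧ belowOut F ℓ A′ B′)
        ≡⟨ cong₂ (λ x y → (x ∧ Q) ∨ (P ∧ y)) (BelowIn.below-flip p ∈i ∈j ¬sim)
                 (BelowOut.below-flip ℓ (stays-inside ∈iℓ) (stays-inside ∈jℓ) ¬same) ⟩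
      (not P ∧ Q) ∨ (P ∧ not Q)
        ≡⟨ ∨-as-xor P Q ⟩
      P xor Q  ∎
    where
    open ≡-Reasoning
    A′ B′ : Fin n
    A′ = π i (suc ℓ)
    B′ = π j (suc ℓ)
    P Q : Bool
    P = precAt F π p j i
    Q = belowOut F ℓ B′ A′
    at-ℓ : T (crossingAt F π p i j) → T ((precAt F π p i j ∧ Q) ∨ (P ∧ belowOut F ℓ A′ B′))
    at-ℓ h with anyF⁻ {f = λ ℓ′ → compEnd F π p ℓ′ i j ∧
                        ((precAt F π p i j ∧ belowOut F ℓ′ (π j (suc ℓ′)) (π i (suc ℓ′))) ∨
                         (precAt F π p j i ∧ belowOut F ℓ′ (π i (suc ℓ′)) (π j (suc ℓ′))))}
                   (proj₂ (T-∧⁻ (meetAt F π p i j) h))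
    ... | ℓ′ , h′ with T-∧⁻ (compEnd F π p ℓ′ i j) h′
    ...   | ce′ , crossed with compEnd-unique ce′ ce
    ...     | refl = crossed

  inside-not-final : ∀ {q i j} → In q (π i (inject₁ q)) → In q (π j (inject₁ q)) → ¬ T (finalAt F π q i j) →
                     SameEdge (suc (toℕ q)) (π i (suc q)) (π j (suc q))
  inside-not-final {q} {i} {j} ∈i ∈j ¬final with T? (sameOut F q (π i (suc q)) (π j (suc q)))
  ... | yes same = proj₂ (proj₂ (to sameOut⇔ same))
  ... | no ¬same = contradiction (from finalAt⇔ (∈i , ∈j , ¬same)) ¬final

  SameEdge-not-final : ∀ {q i j} → SameEdge (toℕ q) (π i (inject₁ q)) (π j (inject₁ q)) →
                       ¬ T (finalAt F π q i j) → SameEdge (suc (toℕ q)) (π i (suc q)) (π j (suc q))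
  SameEdge-not-final {q} {i} {j} e ¬final with In? q (π i (inject₁ q)) | In? q (π j (inject₁ q))
  ... | yes ∈i | yes ∈j = inside-not-final ∈i ∈j ¬final
  ... | yes ∈i | no  ∉j = contradiction (SameEdge-In ∈i e) ∉j
  ... | no  ∉i | yes ∈j = contradiction (SameEdge-In ∈j (SameEdge-sym e)) ∉i
  ... | no  ∉i | no  ∉j rewrite passes-by ∉i | passes-by ∉j =
    to (Across.SameEdge-across q ∉i) e

  together-until-final : ∀ {p i j} → T (meetAt F π p i j) → ∀ g → toℕ p < toℕ g → NoFinal i j p (toℕ g) →
                         SameEdge (toℕ g) (π i g) (π j g)
  together-until-final {p} {i} {j} meet = <-weakInduction Together (λ ()) step
    where
    Together : Fin (suc m) → Set
    Together g = toℕ p < toℕ g → NoFinal i j p (toℕ g) → SameEdge (toℕ g) (π i g) (π j g)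

    step : ∀ q → Together (inject₁ q) → Together (suc q)
    step q ih p≤q no-final with m<1+n⇒m<n∨m≡n p≤q
    ... | inj₂ p≡q with toℕ-injective p≡q
    ...   | refl = let ∈i , ∈j , _ = to meetAt⇔ meet in inside-not-final ∈i ∈j (no-final p ≤-refl ≤-refl)
    step q ih p≤q no-final | inj₁ p<q =
      SameEdge-not-final (SameEdge-inject₁ q
                           (ih (subst (toℕ p <_) (sym (toℕ-inject₁ q)) p<q)
                               (λ q′ p≤q′ q′<q → no-final q′ p≤q′
                                  (<-trans (subst (toℕ q′ <_) (toℕ-inject₁ q) q′<q) (n<1+n _)))))
                         (no-final q (<⇒≤ p<q) ≤-refl)

  final-before-meet : ∀ {p ℓ k i j} → T (compEnd F π p ℓ i j) → T (meetAt F π k i j) →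
                      toℕ p < toℕ k → toℕ ℓ < toℕ k
  final-before-meet {p} {ℓ} {k} {i} {j} ce meet-k p<k with toℕ ℓ <? toℕ k
  ... | yes ℓ<k = ℓ<k
  ... | no  ℓ≮k with to compEnd⇔ ce | to meetAt⇔ meet-k
  ...   | meet-p , _ , _ , before | ∈i , ∈j , ¬sim =
    contradiction (from sameIn⇔ (∈i , ∈j , SameEdge-inject₁ k together-at-k)) ¬sim
    where
    together-at-k : SameEdge (toℕ (inject₁ k)) (π i (inject₁ k)) (π j (inject₁ k))
    together-at-k = together-until-final meet-p (inject₁ k) (subst (toℕ p <_) (sym (toℕ-inject₁ k)) p<k)
      λ q p≤q q<k → before q p≤q (<-≤-trans (subst (toℕ q <_) (toℕ-inject₁ k) q<k) (≮⇒≥ ℓ≮k))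

module Parity {n m} (F : StarExpr n m) (π : Family n m)
  (valid : ∀ i p → T (validStep F (π i) p)) (starts : ∀ i → π i zero ≡ i)
  {a b : Fin n} (a<b : toℕ a < toℕ b) where
  open Edges F
  open Paths F π valid

  crossings : ℕ → ℕ
  crossings x = countF (λ p → (toℕ p <ᵇ x) ∧ crossingAt F π p a b)

  record Component (x : ℕ) : Set where
    field
      start           : Fin m
      start<x         : toℕ start < x
      meets           : T (meetAt F π start a b)
      parity-at-start : odd (crossings (toℕ start)) ≡ precAt F π start b a
      no-final        : NoFinal a b start x
      crossings-since : crossings x ≡ crossings (toℕ start) + 𝟙[ crossingAt F π start a b ]

  Invariant : ℕ → Fin n → Fin n → Set
  Invariant x u v = (¬ SameEdge x u v → T (odd (crossings x)) ⇔ ClassBelow (SameEdge x) v u)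
                  × (SameEdge x u v → Component x)

  crossings-skip : ∀ {r} → ¬ T (meetAt F π r a b) → crossings (suc (toℕ r)) ≡ crossings (toℕ r)
  crossings-skip {r} ¬meet = begin
    crossings (suc (toℕ r))                         ≡⟨ countF-upTo-suc (λ p → crossingAt F π p a b) r ⟩
    crossings (toℕ r) + 𝟙[ crossingAt F π r a b ]  ≡⟨ cong (λ c → crossings (toℕ r) + 𝟙[ c ]) no-crossing ⟩
    crossings (toℕ r) + 0                           ≡⟨ +-identityʳ _ ⟩
    crossings (toℕ r)                               ∎
    where
    open ≡-Reasoning
    no-crossing : crossingAt F π r a b ≡ false
    no-crossing = T-ext (¬meet ∘ proj₁ ∘ T-∧⁻ (meetAt F π r a b)) λ ()

  Component-skip : ∀ {r} → ¬ T (meetAt F π r a b) → ¬ T (finalAt F π r a b) →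
                   Component (toℕ r) → Component (suc (toℕ r))
  Component-skip ¬meet ¬final component = record
    { start = start ; start<x = <-trans start<x (n<1+n _) ; meets = meets ; parity-at-start = parity-at-start
    ; no-final = NoFinal-extend no-final ¬final ; crossings-since = trans (crossings-skip ¬meet) crossings-since }
    where open Component component

  parity-at-meeting : ∀ {r} → T (meetAt F π r a b) →
    Invariant (toℕ r) (π a (inject₁ r)) (π b (inject₁ r)) → odd (crossings (toℕ r)) ≡ precAt F π r b a
  parity-at-meeting {r} meet (apart , _) with to meetAt⇔ meet
  ... | ∈a , ∈b , ¬sim = T-ext (from below⇔ ∘ to (apart ¬same)) (from (apart ¬same) ∘ to below⇔)
    where
    below⇔ : T (precAt F π r b a) ⇔ ClassBelow (SameEdge (toℕ r)) (π b (inject₁ r)) (π a (inject₁ r))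
    below⇔ = BelowIn.below⇔ClassBelow r ∈b ∈a
    ¬same : ¬ SameEdge (toℕ r) (π a (inject₁ r)) (π b (inject₁ r))
    ¬same e = ¬sim (from sameIn⇔ (∈a , ∈b , e))

  through : ∀ r start → T (meetAt F π start a b) → odd (crossings (toℕ start)) ≡ precAt F π start b a →
    toℕ start ≤ toℕ r → NoFinal a b start (toℕ r) →
    crossings (suc (toℕ r)) ≡ crossings (toℕ start) + 𝟙[ crossingAt F π start a b ] →
    In r (π a (inject₁ r)) → In r (π b (inject₁ r)) → Invariant (suc (toℕ r)) (π a (suc r)) (π b (suc r))
  through r start meets parity start≤r no-final count ∈a ∈b with T? (sameOut F r (π a (suc r)) (π b (suc r)))
  ... | yes same = (λ ¬e → contradiction (proj₂ (proj₂ (to sameOut⇔ same))) ¬e) , λ _ → record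
    { start = start ; start<x = s≤s start≤r ; meets = meets ; parity-at-start = parity
    ; no-final = NoFinal-extend no-final (λ final → proj₂ (proj₂ (to finalAt⇔ final)) same)
    ; crossings-since = count }
  ... | no ¬same =
    (λ _ → ⇔.trans (mk⇔ (subst T closes) (subst T (sym closes))) (BelowOut.below⇔ClassBelow r ∈b′ ∈a′)) ,
    (λ e → contradiction (from sameOut⇔ (∈a′ , ∈b′ , e)) ¬same)
    where
    open ≡-Reasoning
    final : T (finalAt F π r a b)
    final = from finalAt⇔ (∈a , ∈b , ¬same)
    ∈a′ : In r (π a (suc r))
    ∈a′ = stays-inside ∈a
    ∈b′ : In r (π b (suc r))
    ∈b′ = stays-inside ∈b
    closes : odd (crossings (suc (toℕ r))) ≡ belowOut F r (π b (suc r)) (π a (suc r))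
    closes = begin
      odd (crossings (suc (toℕ r)))
        ≡⟨ cong odd count ⟩
      odd (crossings (toℕ start) + 𝟙[ crossingAt F π start a b ])
        ≡⟨ odd-+-𝟙 (crossings (toℕ start)) (crossingAt F π start a b) ⟩
      crossingAt F π start a b xor odd (crossings (toℕ start))
        ≡⟨ cong₂ _xor_ (crossingAt-end (from compEnd⇔ (meets , start≤r , final , no-final))) parity ⟩
      (precAt F π start b a xor belowOut F r (π b (suc r)) (π a (suc r))) xor precAt F π start b a
        ≡⟨ xor-cancelʳ (precAt F π start b a) (belowOut F r (π b (suc r)) (π a (suc r))) ⟩
      belowOut F r (π b (suc r)) (π a (suc r))  ∎

  module _ (r : Fin m) where
    open Across r

    pass-outside : ¬ In r (π a (inject₁ r)) → ¬ In r (π b (inject₁ r)) →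
      Invariant (toℕ r) (π a (inject₁ r)) (π b (inject₁ r)) → Invariant (suc (toℕ r)) (π a (suc r)) (π b (suc r))
    pass-outside ∉a ∉b (apart , together) rewrite passes-by ∉a | passes-by ∉b =
      (λ ¬e → ⇔.trans (T-odd-cong (crossings-skip ¬meet))
                (⇔.trans (apart (¬e ∘ to (SameEdge-across ∉a))) (ClassBelow-across-outside ∉b ∉a))) ,
      (λ e → Component-skip ¬meet (∉a ∘ proj₁ ∘ to finalAt⇔) (together (from (SameEdge-across ∉a) e)))
      where
      ¬meet : ¬ T (meetAt F π r a b)
      ¬meet = ∉a ∘ proj₁ ∘ to meetAt⇔

    pass-a-inside : In r (π a (inject₁ r)) → ¬ In r (π b (inject₁ r)) →
      Invariant (toℕ r) (π a (inject₁ r)) (π b (inject₁ r)) → Invariant (suc (toℕ r)) (π a (suc r)) (π b (suc r))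
    pass-a-inside ∈a ∉b (apart , _) rewrite passes-by ∉b =
      (λ _ → ⇔.trans (T-odd-cong (crossings-skip (∉b ∘ proj₁ ∘ proj₂ ∘ to meetAt⇔)))
               (⇔.trans (apart λ e → ∉b (SameEdge-In ∈a e)) (ClassBelow-across-into ∉b ∈a (stays-inside ∈a)))) ,
      (λ e → contradiction (SameEdge-Out (stays-inside ∈a) e) ∉b)

    pass-b-inside : ¬ In r (π a (inject₁ r)) → In r (π b (inject₁ r)) →
      Invariant (toℕ r) (π a (inject₁ r)) (π b (inject₁ r)) → Invariant (suc (toℕ r)) (π a (suc r)) (π b (suc r))
    pass-b-inside ∉a ∈b (apart , _) rewrite passes-by ∉a =
      (λ _ → ⇔.trans (T-odd-cong (crossings-skip (∉a ∘ proj₁ ∘ to meetAt⇔)))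
               (⇔.trans (apart λ e → ∉a (SameEdge-In ∈b (SameEdge-sym e)))
                        (ClassBelow-across-out-of ∉a ∈b (stays-inside ∈b)))) ,
      (λ e → contradiction (SameEdge-Out (stays-inside ∈b) (SameEdge-sym e)) ∉a)

    pass-inside : In r (π a (inject₁ r)) → In r (π b (inject₁ r)) →
      Invariant (toℕ r) (π a (inject₁ r)) (π b (inject₁ r)) → Invariant (suc (toℕ r)) (π a (suc r)) (π b (suc r))
    pass-inside ∈a ∈b inv with T? (simAt F π r a b)
    ... | yes sim =
      through r start meets parity-at-start (<⇒≤ start<x) no-final
              (trans (crossings-skip λ meet → proj₂ (proj₂ (to meetAt⇔ meet)) sim) crossings-since) ∈a ∈b
      where open Component (proj₂ inv (proj₂ (proj₂ (to sameIn⇔ sim))))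
    ... | no ¬sim =
      through r r meet (parity-at-meeting meet inv) ≤-refl
              (λ _ r≤q q<r → contradiction (≤-<-trans r≤q q<r) (<-irrefl refl)) (countF-upTo-suc _ r) ∈a ∈b
      where
      meet : T (meetAt F π r a b)
      meet = from meetAt⇔ (∈a , ∈b , ¬sim)

    step : Invariant (toℕ r) (π a (inject₁ r)) (π b (inject₁ r)) →
           Invariant (suc (toℕ r)) (π a (suc r)) (π b (suc r))
    step with In? r (π a (inject₁ r)) | In? r (π b (inject₁ r))
    ... | yes ∈a | yes ∈b = pass-inside ∈a ∈b
    ... | yes ∈a | no  ∉b = pass-a-inside ∈a ∉b
    ... | no  ∉a | yes ∈b = pass-b-inside ∉a ∈b
    ... | no  ∉a | no  ∉b = pass-outside ∉a ∉b

  base : Invariant 0 (π a zero) (π b zero)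
  base rewrite starts a | starts b = (λ _ → mk⇔ no-crossing b-not-below) , a-not-with-b
    where
    no-crossing : T (odd (crossings 0)) → ClassBelow (SameEdge 0) b a
    no-crossing odd₀ = contradiction (subst (T ∘ odd) (countF-false m) odd₀) λ ()
    b-not-below : ClassBelow (SameEdge 0) b a → T (odd (crossings 0))
    b-not-below (_ , b′ , b≈b′ , b′<[a]) with SameEdge-start b≈b′
    ... | refl = contradiction (b′<[a] a (inj₁ refl)) (<-asym a<b)
    a-not-with-b : SameEdge 0 a b → Component 0
    a-not-with-b e = contradiction (cong toℕ (SameEdge-start e)) (<⇒≢ a<b)

  invariant : ∀ g → Invariant (toℕ g) (π a g) (π b g)
  invariant = <-weakInduction (λ g → Invariant (toℕ g) (π a g) (π b g)) base
    λ r → step r ∘ subst (λ x → Invariant x (π a (inject₁ r)) (π b (inject₁ r))) (toℕ-inject₁ r)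

  parity : ∀ {k} → T (meetAt F π k a b) → odd (crossings (toℕ k)) ≡ precAt F π k b a
  parity {k} meet = parity-at-meeting meet
    (subst (λ x → Invariant x (π a (inject₁ k)) (π b (inject₁ k))) (toℕ-inject₁ k) (invariant (inject₁ k)))

module Defects {n m} (F : StarExpr n m) (π : Family n m)
  (valid : ∀ i p → T (validStep F (π i) p)) (starts : ∀ i → π i zero ≡ i) (k : Fin m) where
  open Edges F

  precAt⇒meetAt : ∀ {i j} → T (precAt F π k j i) → T (meetAt F π k i j)
  precAt⇒meetAt prec with to (BelowIn.below⇔ k) prec
  ... | ∈j , ∈i , j≉i , _ =
    from (Paths.meetAt⇔ F π valid) (∈i , ∈j , λ sim → j≉i (SameEdge-sym (proj₂ (proj₂ (to sameIn⇔ sim)))))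

  defect⇔ : ∀ {i j} → T (defect F π k i j) ⇔ (toℕ i < toℕ j × T (precAt F π k j i))
  defect⇔ {i} {j} = mk⇔
    (λ d → let i<j , d′ = T-∧⁻ (i <ᶠ j) d
               meet , odd-crossings = T-∧⁻ (meetAt F π k i j) d′
           in <ᶠ⇒< i<j , subst T (parity (<ᶠ⇒< i<j) meet) odd-crossings)
    (λ (i<j , prec) → T-∧⁺ (<⇒<ᶠ i<j) (T-∧⁺ (precAt⇒meetAt prec)
                        (subst T (sym (parity i<j (precAt⇒meetAt prec))) prec)))
    where
    parity : ∀ {i j} (i<j : toℕ i < toℕ j) → T (meetAt F π k i j) →
             odd (Parity.crossings F π valid starts i<j (toℕ k)) ≡ precAt F π k j i
    parity i<j = Parity.parity F π valid starts i<j

module Splice {n m} (F : StarExpr n m) (π : Family n m) (valid : ∀ i p → T (validStep F (π i) p))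
  {s t : Fin n} (s≢t : s ≢ t) (ℓ k : Fin m) where
  open Edges F
  open Paths F π valid using (stays-inside)

  swapped : Fin (suc m) → Bool
  swapped g = (toℕ ℓ <ᵇ toℕ g) ∧ (toℕ g ≤ᵇ toℕ k)

  σ : Fin n → Fin n
  σ = transpose s t

  splice : Fin n → Fin n → Fin (suc m) → Fin n
  splice x y g = if swapped g then π y g else π x g

  hat-s : ∀ g → hat π s t ℓ k s g ≡ splice s t g
  hat-s g = if-T (≡⇒== {i = s} refl)

  hat-t : ∀ g → hat π s t ℓ k t g ≡ splice t s g
  hat-t g = trans (if-F (s≢t ∘ sym ∘ ==⇒≡)) (if-T (≡⇒== {i = t} refl))

  hat-other : ∀ {i} → i ≢ s → i ≢ t → ∀ g → hat π s t ℓ k i g ≡ π i g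
  hat-other i≢s i≢t g = trans (if-F (i≢s ∘ ==⇒≡)) (if-F (i≢t ∘ ==⇒≡))

  hat-spliced : ∀ i g → hat π s t ℓ k i g ≡ π (if swapped g then σ i else i) g
  hat-spliced i g = by-cases (i ≟ s) (i ≟ t)
    where
    open ≡-Reasoning
    by-cases : Dec (i ≡ s) → Dec (i ≡ t) → hat π s t ℓ k i g ≡ π (if swapped g then σ i else i) g
    by-cases (yes refl) _ = begin
      hat π s t ℓ k s g                     ≡⟨ hat-s g ⟩
      splice s t g                          ≡⟨ if-float (λ j → π j g) (swapped g) ⟨
      π (if swapped g then t else s) g      ≡⟨ cong (λ j → π (if swapped g then j else s) g) (transpose-left s t) ⟨
      π (if swapped g then σ s else s) g    ∎
    by-cases (no _) (yes refl) = begin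
      hat π s t ℓ k t g                     ≡⟨ hat-t g ⟩
      splice t s g                          ≡⟨ if-float (λ j → π j g) (swapped g) ⟨
      π (if swapped g then s else t) g      ≡⟨ cong (λ j → π (if swapped g then j else t) g) (transpose-right s≢t) ⟨
      π (if swapped g then σ t else t) g    ∎
    by-cases (no i≢s) (no i≢t) = begin
      hat π s t ℓ k i g                     ≡⟨ hat-other i≢s i≢t g ⟩
      π i g                                 ≡⟨ cong (λ j → π j g) (if-same (swapped g)) ⟨
      π (if swapped g then i else i) g      ≡⟨ cong (λ j → π (if swapped g then j else i) g) (transpose-other i≢s i≢t) ⟨
      π (if swapped g then σ i else i) g    ∎

  swapped⇔ : ∀ {g} → T (swapped g) ⇔ (toℕ ℓ < toℕ g × toℕ g ≤ toℕ k)
  swapped⇔ {g} = mk⇔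
    (λ h → let ℓ<g , g≤k = T-∧⁻ (toℕ ℓ <ᵇ toℕ g) h in <ᵇ⇒< _ _ ℓ<g , ≤ᵇ⇒≤ _ _ g≤k)
    (λ (ℓ<g , g≤k) → T-∧⁺ (<⇒<ᵇ ℓ<g) (≤⇒≤ᵇ g≤k))

  leaves-at-k : ∀ {q} → T (swapped (inject₁ q)) → ¬ T (swapped (suc q)) → q ≡ k
  leaves-at-k {q} sw ¬sw′ with to (swapped⇔ {inject₁ q}) sw
  ... | ℓ<q , q≤k = toℕ-injective (≤-antisym (subst (_≤ toℕ k) (toℕ-inject₁ q) q≤k) (≮⇒≥ λ q<k →
    ¬sw′ (from swapped⇔ (<-trans (subst (toℕ ℓ <_) (toℕ-inject₁ q) ℓ<q) (n<1+n _) , q<k))))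

  enters-at-ℓ : ∀ {q} → ¬ T (swapped (inject₁ q)) → T (swapped (suc q)) → q ≡ ℓ
  enters-at-ℓ {q} ¬sw sw′ with to (swapped⇔ {suc q}) sw′
  ... | ℓ≤q , q<k = toℕ-injective (≤-antisym (≮⇒≥ λ ℓ<q → ¬sw (from swapped⇔
    (subst (toℕ ℓ <_) (sym (toℕ-inject₁ q)) ℓ<q , subst (_≤ toℕ k) (sym (toℕ-inject₁ q)) (<⇒≤ q<k)))) (s≤s⁻¹ ℓ≤q))

  BothVisit : Fin m → Fin n → Fin n → Set
  BothVisit q x y = In q (π x (inject₁ q)) × In q (π y (inject₁ q))

  splice-valid : ∀ {x y} → BothVisit ℓ x y → BothVisit k x y → ∀ q → T (validStep F (splice x y) q)
  splice-valid {x} {y} at-ℓ at-k q with T? (swapped (inject₁ q)) | T? (swapped (suc q))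
  ... | yes sw | yes sw′ = validStep-cong (splice x y) (π y) (if-T sw) (if-T sw′) (valid y q)
  ... | no ¬sw | no ¬sw′ = validStep-cong (splice x y) (π x) (if-F ¬sw) (if-F ¬sw′) (valid x q)
  ... | yes sw | no ¬sw′ with leaves-at-k sw ¬sw′
  ...   | refl = validStep-inside (splice x y) (subst (In q) (sym (if-T sw)) (proj₂ at-k))
                                  (subst (In q) (sym (if-F ¬sw′)) (stays-inside (proj₁ at-k)))
  splice-valid {x} {y} at-ℓ at-k q | no ¬sw | yes sw′ with enters-at-ℓ ¬sw sw′
  ...   | refl = validStep-inside (splice x y) (subst (In q) (sym (if-F ¬sw)) (proj₁ at-ℓ))
                                  (subst (In q) (sym (if-T sw′)) (stays-inside (proj₂ at-ℓ)))

  hat-valid : BothVisit ℓ s t → BothVisit k s t → ∀ i q → T (validStep F (hat π s t ℓ k i) q)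
  hat-valid at-ℓ at-k i q with i ≟ s | i ≟ t
  ... | yes refl | _ =
    validStep-cong (hat π s t ℓ k s) (splice s t) (hat-s _) (hat-s _) (splice-valid at-ℓ at-k q)
  ... | no _ | yes refl =
    validStep-cong (hat π s t ℓ k t) (splice t s) (hat-t _) (hat-t _) (splice-valid (swap at-ℓ) (swap at-k) q)
    where
    swap : ∀ {q} → BothVisit q s t → BothVisit q t s
    swap (∈s , ∈t) = ∈t , ∈s
  ... | no i≢s | no i≢t =
    validStep-cong (hat π s t ℓ k i) (π i) (hat-other i≢s i≢t _) (hat-other i≢s i≢t _) (valid i q)

  hat-starts : (∀ i → π i zero ≡ i) → ∀ i → hat π s t ℓ k i zero ≡ i
  hat-starts starts i = trans (hat-spliced i zero) (starts i)

  hat-at : toℕ ℓ < toℕ k → ∀ i → hat π s t ℓ k i (inject₁ k) ≡ π (σ i) (inject₁ k)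
  hat-at ℓ<k i = trans (hat-spliced i (inject₁ k)) (cong (λ j → π j (inject₁ k)) (if-T inside))
    where
    inside : T (swapped (inject₁ k))
    inside = from swapped⇔ (subst (toℕ ℓ <_) (sym (toℕ-inject₁ k)) ℓ<k ,
                            subst (_≤ toℕ k) (sym (toℕ-inject₁ k)) ≤-refl)

module Membership {n m} (F : StarExpr n m) (ρ : Family n m) (k : Fin m) (s t : Fin n) where

  member⇔ : ∀ {i} → T ((i == s) ∨ (i == t)) ⇔ (i ≡ s ⊎ i ≡ t)
  member⇔ {i} = mk⇔ decode encode
    where
    decode : T ((i == s) ∨ (i == t)) → i ≡ s ⊎ i ≡ t
    decode h with T-∨⁻ (i == s) h
    ... | inj₁ i=s = inj₁ (==⇒≡ i=s)
    ... | inj₂ i=t = inj₂ (==⇒≡ i=t)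
    encode : i ≡ s ⊎ i ≡ t → T ((i == s) ∨ (i == t))
    encode (inj₁ i≡s) = T-∨⁺ˡ (i == t) (≡⇒== i≡s)
    encode (inj₂ i≡t) = T-∨⁺ʳ (i == s) (≡⇒== i≡t)

  nonmember : ∀ {i} → i ≢ s → i ≢ t → ¬ T ((i == s) ∨ (i == t))
  nonmember i≢s i≢t = [ i≢s , i≢t ]′ ∘ to member⇔

  inD-left : ∀ {i j} → i ≡ s ⊎ i ≡ t → j ≢ s → j ≢ t → T (defect F ρ k i j) → T (inD F ρ k s t i j)
  inD-left i∈ j≢s j≢t d = T-∧⁺ d (T-xor⁺ˡ (from member⇔ i∈) (nonmember j≢s j≢t))

  inD-right : ∀ {i j} → i ≢ s → i ≢ t → j ≡ s ⊎ j ≡ t → T (defect F ρ k i j) → T (inD F ρ k s t i j)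
  inD-right i≢s i≢t j∈ d = T-∧⁺ d (T-xor⁺ʳ (nonmember i≢s i≢t) (from member⇔ j∈))

  inD-member-left : ∀ {i j} → T (inD F ρ k s t i j) → ¬ (j ≡ s ⊎ j ≡ t) → i ≡ s ⊎ i ≡ t
  inD-member-left {i} {j} h j∉ =
    [ to member⇔ , (λ j∈ → contradiction (to member⇔ j∈) j∉) ]′ (T-xor⁻ (proj₂ (T-∧⁻ (defect F ρ k i j) h)))

  inD-member-right : ∀ {i j} → T (inD F ρ k s t i j) → ¬ (i ≡ s ⊎ i ≡ t) → j ≡ s ⊎ j ≡ t
  inD-member-right {i} {j} h i∉ =
    [ (λ i∈ → contradiction (to member⇔ i∈) i∉) , to member⇔ ]′ (T-xor⁻ (proj₂ (T-∧⁻ (defect F ρ k i j) h)))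

  inC1⁻ : ∀ {i j} → T (inC1 F ρ k s t i j) →
          T (defect F ρ k s j) × T (precsimAt F ρ k t j) × T (precAt F ρ k j s) × j ≢ t
  inC1⁻ {i} {j} h =
    let D , h₁ = T-∧⁻ (inD F ρ k s t i j) h
        t≼j , h₂ = T-∧⁻ (precsimAt F ρ k t j) h₁
        j≺i , h₃ = T-∧⁻ (precAt F ρ k j i) h₂
        i=s , j≠t = T-∧⁻ (i == s) h₃
        i≡s = ==⇒≡ {i = i} {j = s} i=s
    in subst (λ i → T (defect F ρ k i j)) i≡s (proj₁ (T-∧⁻ (defect F ρ k i j) D)) , t≼j ,
       subst (λ i → T (precAt F ρ k j i)) i≡s j≺i , T-not⁻ j≠t ∘ ≡⇒==

  inC2⁻ : ∀ {i j} → T (inC2 F ρ k s t i j) →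
          T (defect F ρ k i t) × T (precAt F ρ k t i) × T (precsimAt F ρ k i s) × i ≢ s
  inC2⁻ {i} {j} h =
    let D , h₁ = T-∧⁻ (inD F ρ k s t i j) h
        j=t , h₂ = T-∧⁻ (j == t) h₁
        t≺i , h₃ = T-∧⁻ (precAt F ρ k t i) h₂
        i≼s , i≠s = T-∧⁻ (precsimAt F ρ k i s) h₃
    in subst (λ j → T (defect F ρ k i j)) (==⇒≡ {i = j} {j = t} j=t) (proj₁ (T-∧⁻ (defect F ρ k i j) D)) ,
       t≺i , i≼s , T-not⁻ i≠s ∘ ≡⇒==

  inA′⁺ : ∀ {i j} → T (inD F ρ k s t i j) → T (precAt F ρ k j s) → T (inA' F ρ k s t i j)
  inA′⁺ {i} {j} = T-∧⁺ {inD F ρ k s t i j}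

  inB′⁺ : ∀ {i j} → T (inD F ρ k s t i j) → T (precAt F ρ k t i) → T (inB' F ρ k s t i j)
  inB′⁺ {i} {j} = T-∧⁺ {inD F ρ k s t i j}

  inC1′⁺ : ∀ {j} → T (inD F ρ k s t t j) → T (precsimAt F ρ k s j) → T (precAt F ρ k j t) → j ≢ s →
           T (inC1' F ρ k s t t j)
  inC1′⁺ {j} D s≼j j≺t j≢s =
    T-∧⁺ {inD F ρ k s t t j} D (T-∧⁺ {precsimAt F ρ k s j} s≼j (T-∧⁺ {precAt F ρ k j t} j≺t
      (T-∧⁺ {t == t} (≡⇒== {i = t} refl) (T-not⁺ (j≢s ∘ ==⇒≡)))))

  inC2′⁺ : ∀ {i} → T (inD F ρ k s t i s) → T (precAt F ρ k s i) → T (precsimAt F ρ k i t) → i ≢ t →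
           T (inC2' F ρ k s t i s)
  inC2′⁺ {i} D s≺i i≼t i≢t =
    T-∧⁺ {inD F ρ k s t i s} D (T-∧⁺ {s == s} (≡⇒== {i = s} refl) (T-∧⁺ {precAt F ρ k s i} s≺i
      (T-∧⁺ {precsimAt F ρ k i t} i≼t (T-not⁺ (i≢t ∘ ==⇒≡)))))

module Setting {n m} (F : StarExpr n m) (π : Family n m) (covering : IsCovering F π)
  (k : Fin m) (r t s : Fin n) (ℓ : Fin m)
  (defect-rt : T (defect F π k r t))
  (least-rt : ∀ i j → T (defect F π k i j) → T ((r <ᶠ i) ∨ ((r == i) ∧ (t ≤ᶠ j))))
  (s∼r : T (simAt F π k s r)) (defect-st : T (defect F π k s t))
  (greatest-s : ∀ s′ → T (simAt F π k s′ r) → T (defect F π k s′ t) → T (s′ ≤ᶠ s))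
  (last-crossing : Σ (Fin m) λ p → T (p <ᶠ k) × T (crossingAt F π p s t) × T (compEnd F π p ℓ s t)
                     × (∀ p′ → T (p <ᶠ p′) → T (p′ <ᶠ k) → T (not (crossingAt F π p′ s t)))) where
  open Edges F

  valid : ∀ i p → T (validStep F (π i) p)
  valid = proj₁ covering

  starts : ∀ i → π i zero ≡ i
  starts = proj₁ (proj₂ covering)

  open Paths F π valid using (meetAt⇔; finalAt⇔; compEnd⇔; final-before-meet)
  open Defects F π valid starts k using (defect⇔)

  _≺_ _∼_ : Fin n → Fin n → Set
  i ≺ j = T (precAt F π k i j)
  i ∼ j = T (simAt F π k i j)

  wire : Fin n → Fin n
  wire i = π i (inject₁ k)

  ≺-irrefl : ∀ {i} → ¬ i ≺ i
  ≺-irrefl {i} = BelowIn.below-irrefl k {wire i}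

  ≺-trans : ∀ {i j l} → i ≺ j → j ≺ l → i ≺ l
  ≺-trans {i} {j} {l} = BelowIn.below-trans k {wire i} {wire j} {wire l}

  ≺-asym : ∀ {i j} → i ≺ j → ¬ j ≺ i
  ≺-asym {i} {j} = BelowIn.below-asym k {wire i} {wire j}

  ≺-respʳ : ∀ {i j l} → i ≺ j → j ∼ l → i ≺ l
  ≺-respʳ {i} {j} {l} = BelowIn.below-respʳ k {wire i} {wire j} {wire l}

  ∼-trans : ∀ {i j l} → i ∼ j → j ∼ l → i ∼ l
  ∼-trans ij jl with to sameIn⇔ ij | to sameIn⇔ jl
  ... | ∈i , _ , i≈j | _ , ∈l , j≈l = from sameIn⇔ (∈i , ∈l , SameEdge-trans i≈j j≈l)

  s<t : toℕ s < toℕ t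
  s<t = proj₁ (to defect⇔ defect-st)

  t≺s : t ≺ s
  t≺s = proj₂ (to defect⇔ defect-st)

  s≢t : s ≢ t
  s≢t = Fin.<⇒≢ s<t

  meet-st : T (meetAt F π k s t)
  meet-st = Defects.precAt⇒meetAt F π valid starts k t≺s

  ends-at-ℓ : T (compEnd F π (proj₁ last-crossing) ℓ s t)
  ends-at-ℓ = proj₁ (proj₂ (proj₂ (proj₂ last-crossing)))

  ℓ<k : toℕ ℓ < toℕ k
  ℓ<k = final-before-meet ends-at-ℓ meet-st (<ᶠ⇒< (proj₁ (proj₂ last-crossing)))

  module S = Splice F π valid s≢t ℓ k
  open S using (σ)

  π̂ : Family n m
  π̂ = hat π s t ℓ k

  valid̂ : ∀ i p → T (validStep F (π̂ i) p)
  valid̂ = S.hat-valid (both-visit (to finalAt⇔ (proj₁ (proj₂ (proj₂ (to compEnd⇔ ends-at-ℓ))))))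
                      (both-visit (to meetAt⇔ meet-st))
    where
    both-visit : ∀ {A B C : Set} → A × B × C → A × B
    both-visit (a , b , _) = a , b

  ≺̂⁺ : ∀ i j {i′ j′} → σ i ≡ i′ → σ j ≡ j′ → i′ ≺ j′ → T (precAt F π̂ k i j)
  ≺̂⁺ i j refl refl = subst T (sym (cong₂ (belowIn F k) (S.hat-at ℓ<k i) (S.hat-at ℓ<k j)))

  ≼̂⁺ : ∀ i j {i′ j′} → σ i ≡ i′ → σ j ≡ j′ → T (precsimAt F π k i′ j′) → T (precsimAt F π̂ k i j)
  ≼̂⁺ i j refl refl =
    subst T (sym (cong₂ (λ u v → belowIn F k u v ∨ sameIn F k u v) (S.hat-at ℓ<k i) (S.hat-at ℓ<k j)))

  defect̂ : ∀ i j {i′ j′} → toℕ i < toℕ j → σ j ≡ j′ → σ i ≡ i′ → j′ ≺ i′ → T (defect F π̂ k i j)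
  defect̂ i j i<j σj≡j′ σi≡i′ j′≺i′ =
    from (Defects.defect⇔ F π̂ valid̂ (S.hat-starts starts) k) (i<j , ≺̂⁺ j i σj≡j′ σi≡i′ j′≺i′)

  module M = Membership F π k s t
  module M̂ = Membership F π̂ k s t

  σs≡t : σ s ≡ t
  σs≡t = transpose-left s t

  σt≡s : σ t ≡ s
  σt≡s = transpose-right s≢t

  r≤s : toℕ r ≤ toℕ s
  r≤s = ≤ᶠ⇒≤ (greatest-s r r∼r defect-rt)
    where
    r∼r : r ∼ r
    r∼r = let ∈r , _ , _ = to (meetAt⇔ {k} {r} {t}) (Defects.precAt⇒meetAt F π valid starts k (proj₂ (to defect⇔ defect-rt)))
          in from sameIn⇔ (∈r , ∈r , inj₁ refl)

  t-least : ∀ {j} → toℕ s < toℕ j → j ≺ s → toℕ t ≤ toℕ j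
  t-least {j} s<j j≺s =
    [ (λ r<r → contradiction (<ᶠ⇒< {i = r} {j = r} r<r) (<-irrefl refl))
    , (λ t≤j → ≤ᶠ⇒≤ {i = t} {j = j} (proj₂ (T-∧⁻ (r == r) t≤j)))
    ]′ (T-∨⁻ (r <ᶠ r) (least-rt r j (from defect⇔ (≤-<-trans r≤s s<j , ≺-respʳ j≺s s∼r))))

  ψ-A : ∀ {i j} → T (inA F π k s t i j) → T (inD F π̂ k s t i j) × T (inA' F π̂ k s t i j)
  ψ-A {i} {j} h = D̂ , M̂.inA′⁺ {i} {j} D̂ (≺̂⁺ j s σj≡j σs≡t j≺t)
    where
    D : T (inD F π k s t i j)
    D = proj₁ (T-∧⁻ (inD F π k s t i j) h)
    j≺t : j ≺ t
    j≺t = proj₂ (T-∧⁻ (inD F π k s t i j) h)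
    i<j : toℕ i < toℕ j
    i<j = proj₁ (to (defect⇔ {i} {j}) (proj₁ (T-∧⁻ (defect F π k i j) D)))
    j≢s : j ≢ s
    j≢s refl = ≺-asym j≺t t≺s
    j≢t : j ≢ t
    j≢t refl = ≺-irrefl j≺t
    σj≡j : σ j ≡ j
    σj≡j = transpose-other j≢s j≢t
    i∈ : i ≡ s ⊎ i ≡ t
    i∈ = M.inD-member-left D [ j≢s , j≢t ]′
    j≺σi : j ≺ σ i
    j≺σi = [ (λ { refl → subst (j ≺_) (sym σs≡t) j≺t })
           , (λ { refl → subst (j ≺_) (sym σt≡s) (≺-trans j≺t t≺s) })
           ]′ i∈
    D̂ : T (inD F π̂ k s t i j)
    D̂ = M̂.inD-left i∈ j≢s j≢t (defect̂ i j i<j σj≡j refl j≺σi)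

  ψ-B : ∀ {i j} → T (inB F π k s t i j) → T (inD F π̂ k s t i j) × T (inB' F π̂ k s t i j)
  ψ-B {i} {j} h = D̂ , M̂.inB′⁺ {i} {j} D̂ (≺̂⁺ t i σt≡s σi≡i s≺i)
    where
    D : T (inD F π k s t i j)
    D = proj₁ (T-∧⁻ (inD F π k s t i j) h)
    s≺i : s ≺ i
    s≺i = proj₂ (T-∧⁻ (inD F π k s t i j) h)
    i<j : toℕ i < toℕ j
    i<j = proj₁ (to (defect⇔ {i} {j}) (proj₁ (T-∧⁻ (defect F π k i j) D)))
    i≢s : i ≢ s
    i≢s refl = ≺-irrefl s≺i
    i≢t : i ≢ t
    i≢t refl = ≺-asym s≺i t≺s
    σi≡i : σ i ≡ i
    σi≡i = transpose-other i≢s i≢t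
    j∈ : j ≡ s ⊎ j ≡ t
    j∈ = M.inD-member-right D [ i≢s , i≢t ]′
    σj≺i : σ j ≺ i
    σj≺i = [ (λ { refl → subst (_≺ i) (sym σs≡t) (≺-trans t≺s s≺i) })
           , (λ { refl → subst (_≺ i) (sym σt≡s) s≺i })
           ]′ j∈
    D̂ : T (inD F π̂ k s t i j)
    D̂ = M̂.inD-right i≢s i≢t j∈ (defect̂ i j i<j refl σi≡i σj≺i)

  ψ-C₁ : ∀ {i j} → T (inC1 F π k s t i j) → T (inD F π̂ k s t t j) × T (inC1' F π̂ k s t t j)
  ψ-C₁ {i} {j} = image ∘ M.inC1⁻ {i} {j}
    where
    image : T (defect F π k s j) × T (precsimAt F π k t j) × j ≺ s × j ≢ t →
            T (inD F π̂ k s t t j) × T (inC1' F π̂ k s t t j)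
    image (d , t≼j , j≺s , j≢t) =
      D̂ , M̂.inC1′⁺ D̂ (≼̂⁺ s j σs≡t σj≡j t≼j) (≺̂⁺ j t σj≡j σt≡s j≺s) j≢s
      where
      s<j : toℕ s < toℕ j
      s<j = proj₁ (to (defect⇔ {s} {j}) d)
      j≢s : j ≢ s
      j≢s refl = <-irrefl refl s<j
      σj≡j : σ j ≡ j
      σj≡j = transpose-other j≢s j≢t
      t<j : toℕ t < toℕ j
      t<j = ≤∧≢⇒< (t-least s<j j≺s) (j≢t ∘ toℕ-injective ∘ sym)
      D̂ : T (inD F π̂ k s t t j)
      D̂ = M̂.inD-left (inj₂ refl) j≢s j≢t (defect̂ t j t<j σj≡j σt≡s j≺s)

  ψ-C₂ : ∀ {i j} → T (inC2 F π k s t i j) → T (inD F π̂ k s t i s) × T (inC2' F π̂ k s t i s)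
  ψ-C₂ {i} {j} = image ∘ M.inC2⁻ {i} {j}
    where
    image : T (defect F π k i t) × t ≺ i × T (precsimAt F π k i s) × i ≢ s →
            T (inD F π̂ k s t i s) × T (inC2' F π̂ k s t i s)
    image (d , t≺i , i≼s , i≢s) =
      D̂ , M̂.inC2′⁺ D̂ (≺̂⁺ s i σs≡t σi≡i t≺i) (≼̂⁺ i t σi≡i σt≡s i≼s) i≢t
      where
      i<t : toℕ i < toℕ t
      i<t = proj₁ (to (defect⇔ {i} {t}) d)
      i≢t : i ≢ t
      i≢t refl = <-irrefl refl i<t
      σi≡i : σ i ≡ i
      σi≡i = transpose-other i≢s i≢t
      i<s : toℕ i < toℕ s
      i<s = decidable-stable (toℕ i <? toℕ s) λ i≮s →
        let s<i = ≤∧≢⇒< (≮⇒≥ i≮s) (i≢s ∘ sym ∘ toℕ-injective)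
        in [ (λ i≺s → contradiction (t-least s<i i≺s) (<⇒≱ i<t))
           , (λ i∼s → contradiction (≤ᶠ⇒≤ {i = i} {j = s} (greatest-s i (∼-trans i∼s s∼r) d)) (<⇒≱ s<i))
           ]′ (T-∨⁻ (precAt F π k i s) i≼s)
      D̂ : T (inD F π̂ k s t i s)
      D̂ = M̂.inD-right i≢s i≢t (inj₁ refl) (defect̂ i s i<s σs≡t σi≡i t≺i)

lemma4p4 : ∀ {n m} (F : StarExpr n m) (π : Family n m) → IsCovering F π →
  (k : Fin m) → 1 ≤ toℕ k →
  (r t s : Fin n) (ℓ : Fin m) →
  -- (r,t): lexicographically least pair with (π_r, π_t, k) a defect
  T (defect F π k r t) →
  (∀ i j → T (defect F π k i j) → T ((r <ᶠ i) ∨ ((r == i) ∧ (t ≤ᶠ j)))) →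
  -- s: largest index with π_s ∼ π_r at x_k and (π_s, π_t, k) a defect
  T (simAt F π k s r) → T (defect F π k s t) →
  (∀ s' → T (simAt F π k s' r) → T (defect F π k s' t) → T (s' ≤ᶠ s)) →
  -- x_ℓ: final vertex of the rightmost crossing of π_s, π_t prior to x_k
  Σ (Fin m) (λ p → T (p <ᶠ k) × T (crossingAt F π p s t) × T (compEnd F π p ℓ s t)
    × (∀ p' → T (p <ᶠ p') → T (p' <ᶠ k) → T (not (crossingAt F π p' s t)))) →
  -- conclusion, with π̂ = hat π s t ℓ k
  ∀ i j → T (inD F π k s t i j) →
    (T (inA F π k s t i j) →
       T (inD F (hat π s t ℓ k) k s t i j) × T (inA' F (hat π s t ℓ k) k s t i j))
    × (T (inB F π k s t i j) →
       T (inD F (hat π s t ℓ k) k s t i j) × T (inB' F (hat π s t ℓ k) k s t i j))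
    × (T (inC1 F π k s t i j) →
       T (inD F (hat π s t ℓ k) k s t t j) × T (inC1' F (hat π s t ℓ k) k s t t j))
    × (T (inC2 F π k s t i j) →
       T (inD F (hat π s t ℓ k) k s t i s) × T (inC2' F (hat π s t ℓ k) k s t i s))
-- Of the hypothesis on x_ℓ we only use that x_ℓ ends a component of π_s, π_t begun before x_k;
-- k ≥ 2 and membership in D(π) (implied by each of the four cases) are not needed.
lemma4p4 F π covering k _ r t s ℓ defect-rt least-rt s∼r defect-st greatest-s last-crossing i j _ =
  ψ-A {i} {j} , ψ-B {i} {j} , ψ-C₁ {i} {j} , ψ-C₂ {i} {j}
  where open Setting F π covering k r t s ℓ defect-rt least-rt s∼r defect-st greatest-s last-crossing
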